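{- Let $\Phi(\vec x)=\bigwedge_{i=1}^m f_i\mid g_i$ be a system of divisibility constraints in $d$ variables. Then $\log_2\big(\prod\mathbb{P}(\Phi)\big)\le m^2(d+2)\cdot(\langle\|\Phi\|_\infty\rangle+2)$. Furthermore, if $\Phi$ has the elimination property for an order $\prec$ on $\vec x$, then $\log_2\big(\prod\mathbb{P}_0(\Phi)\big)\le 64\cdot m^5(d+2)^4(\langle\|\Phi\|_\infty\rangle+2)$.
   Context: Linear polynomials $f=a_1x_1+\dots+a_dx_d+c$ have integer coefficients and constant; $\gcd(f)=\gcd(a_1,\dots,a_d,c)$; $f$ is primitive if $f\ne0$ and $\gcd(f)=1$; the primitive part of a non-zero $g$ is the primitive $f$ with $g=\gcd(g)f$; $\mathbb{Z}[x_1,\dots,x_k]$ denotes linear polynomials in $x_1,\dots,x_k$ only. Divisibility $m\mid n$ of integers holds iff $n=qm$ for a unique $q\in\mathbb{Z}$. A system of divisibility constraints is $\bigwedge_{i=1}^m f_i\mid g_i$ with linear polynomials $f_i\neq 0$, $g_i$; $\mathrm{terms}(\Phi)=\{f_i,g_i\}$; $\|f\|_\infty$ is the maximum absolute value of coefficients and constant of $f$, $\|\Phi\|_\infty=\max_{f\in\mathrm{terms}(\Phi)}\|f\|_\infty$, and $\langle a\rangle=1+\lceil\log_2(|a|+1)\rceil$. $\prod S$ is the product of the elements of a finite set $S$. $\mathbb{P}(\Phi)$ is the set of primes $p$ with $p\le m$ or $p$ dividing a coefficient or constant of some $f_i$. For an order $x_1\prec\dots\prec x_d$, $\mathrm{lv}(f)$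 is the $\prec$-largest variable with non-zero coefficient in $f$ ($\bot$ if $f$ constant, $\bot\prec x_i$, and $x_0:=\bot$). Divisibility module $M_f(\Phi)$ (for primitive $f$): smallest set of linear polynomials containing $f$, closed under integer linear combinations, and such that if $g\mid h$ is in $\Phi$ and $bg\in M_f(\Phi)$ ($b\in\mathbb{Z}$) then $bh\in M_f(\Phi)$. Elimination property for $\prec$: for every primitive part $f$ of a left-hand side of $\Phi$ and every $0\le k\le d$, the set $\{g:\mathrm{lv}(g)\preceq x_k\text{ and } f\mid g\text{ appears in }\Phi\}$ is linearly independent and a basis of $M_f(\Phi)\cap\mathbb{Z}[x_1,\dots,x_k]$. S-polynomial: for $f,g$ with $\mathrm{lv}(f)=x_l$, $\mathrm{lv}(g)=x_k$, $S(f,g):=b_k f-a_l g$ where $a_l$ is the coefficient of $x_l$ in $f$ and $b_k$ that of $x_k$ in $g$ (if $f$ is constant, $a_l:=f$; if $g$ is constant, $b_k:=g$). For a set $X$ of polynomials, $S(X):=X\cup\{S(f,g):f,g\in X\}$. For $\Phi$ with the elimination property for $\prec$ and primitive $f$, $\Delta_f(\Phi)$ is the smallest set such that $\mathrm{terms}(\Phi)\subseteq\Delta_f(\Phi)$ and if $f\mid g$ occurs in $\Phi$ and $h\in\Delta_f(\Phi)$ with $\mathrm{lv}(g)=\mathrm{lv}(h)$ then $S(g,h)\in\Delta_f(\Phi)$; $\Delta(\Phi)$ is the union of $\Delta_f(\Phi)$ over all $f$ that are primitive parts of polynomials in $\mathrm{terms}(\Phi)$. The set of difficult primes $\mathbb{P}_0(\Phi)$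 is the set of primes $p$ such that (P1) $p\le|S(\Delta(\Phi))|$, or (P2) $p$ divides some non-zero coefficient or constant of a polynomial in $S(\Delta(\Phi))$, or (P3) for some primitive polynomial $f$ occurring in $\Phi$ and some $g\in\Delta_f(\Phi)$, $p$ divides the smallest (in absolute value) non-zero $\lambda\in\mathbb{Z}$ with $\lambda g\in M_f(\Phi)$ (when such $\lambda$ exists). -}

module Defs where

open import Data.Nat as ℕ using (ℕ; zero; suc; _≤_; _^_; _⊔_)
open import Data.Nat.Divisibility using (_∣_)
open import Data.Nat.Primality using (Prime)
open import Data.Nat.GCD using (gcd)
open import Data.Nat.Logarithm using (⌈log₂_⌉)
open import Data.Integer as ℤ using (ℤ; ∣_∣; +_)
open import Data.Fin using (Fin; toℕ)
open import Data.Vec as Vec using (Vec; lookup)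
open import Data.List as List using (List; length; allFin; foldr)
open import Data.Nat.ListAction using (product)
open import Data.List.Membership.Propositional using (_∈_)
open import Data.List.Relation.Unary.All using (All)
open import Data.List.Relation.Unary.Any using (Any)
open import Data.List.Relation.Unary.Unique.Propositional using (Unique)
open import Data.Product using (Σ; ∃; _×_; _,_; proj₁; proj₂)
open import Data.Sum using (_⊎_)
open import Data.Bool using (Bool; true; false; if_then_else_; _∧_; not)
open import Relation.Nullary using (¬_; does)
open import Relation.Binary.PropositionalEquality using (_≡_; _≢_)
open import Function.Definitions using (Injective)

record LinPoly (d : ℕ) : Set where
  constructor lin
  field
    coef  : Vec ℤ d
    const : ℤ
open LinPoly public

0P : ∀ {d} → LinPoly d
0P = lin (Vec.replicate _ (+ 0)) (+ 0)

_⊕_ : ∀ {d} → LinPoly d → LinPoly d → LinPoly d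
f ⊕ g = lin (Vec.zipWith ℤ._+_ (coef f) (coef g)) (const f ℤ.+ const g)

_•_ : ∀ {d} → ℤ → LinPoly d → LinPoly d
c • f = lin (Vec.map (c ℤ.*_) (coef f)) (c ℤ.* const f)

_⊖_ : ∀ {d} → LinPoly d → LinPoly d → LinPoly d
f ⊖ g = f ⊕ (ℤ.-[1+ 0 ] • g)

entries : ∀ {d} → LinPoly d → List ℤ
entries f = const f List.∷ Vec.toList (coef f)

gcdP : ∀ {d} → LinPoly d → ℕ
gcdP f = foldr (λ a acc → gcd ∣ a ∣ acc) 0 (entries f)

Primitive : ∀ {d} → LinPoly d → Set
Primitive f = f ≢ 0P × gcdP f ≡ 1

PrimPartOf : ∀ {d} → LinPoly d → LinPoly d → Set
PrimPartOf f g = g ≢ 0P × Primitive f × g ≡ (+ gcdP g) • f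

norm : ∀ {d} → LinPoly d → ℕ
norm f = foldr (λ a acc → ∣ a ∣ ⊔ acc) 0 (entries f)

bitlen : ℕ → ℕ
bitlen a = 1 ℕ.+ ⌈log₂ (a ℕ.+ 1) ⌉

DividesNZEntry : ∀ {d} → ℕ → LinPoly d → Set
DividesNZEntry p f = Any (λ a → a ≢ + 0 × p ∣ ∣ a ∣) (entries f)

-- Systems of divisibility constraints ⋀ᵢ fᵢ ∣ gᵢ

System : ℕ → Set
System d = List (LinPoly d × LinPoly d)

WellFormed : ∀ {d} → System d → Set
WellFormed Φ = All (λ c → proj₁ c ≢ 0P) Φ

Term : ∀ {d} → System d → LinPoly d → Set
Term Φ t = Any (λ c → proj₁ c ≡ t ⊎ proj₂ c ≡ t) Φ

normS : ∀ {d} → System d → ℕ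
normS Φ = foldr (λ c acc → norm (proj₁ c) ⊔ norm (proj₂ c) ⊔ acc) 0 Φ

PP : ∀ {d} → System d → ℕ → Set
PP Φ p = Prime p × (p ≤ length Φ ⊎ Any (λ c → DividesNZEntry p (proj₁ c)) Φ)

-- "log₂ (∏ S) ≤ B" for a finite set S of naturals given as a predicate:
-- every duplicate-free list of elements of S has product ≤ 2^B.
LogProdLE : (ℕ → Set) → ℕ → Set
LogProdLE S B = (ps : List ℕ) → Unique ps → All S ps → product ps ≤ 2 ^ B

-- Orders on the variables: rk i is the position of x_i in the order
-- (x with rank 0 is ≺-smallest); rk is injective.

Order : ℕ → Set
Order d = Fin d → Fin d

-- (level, leading coefficient): level 0 means lv = ⊥ (f constant) and then
-- the leading coefficient is the constant of f; level (suc r) means lv(f) is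
-- the variable of rank r, and the coefficient is that variable's coefficient.
lead : ∀ {d} → Order d → LinPoly d → ℕ × ℤ
lead {d} rk f = foldr step (0 , const f) (allFin d)
  where
  step : Fin d → ℕ × ℤ → ℕ × ℤ
  step i (l , c) =
    if not (does (lookup (coef f) i ℤ.≟ + 0)) ∧ (l ℕ.<ᵇ suc (toℕ (rk i)))
    then (suc (toℕ (rk i)) , lookup (coef f) i)
    else (l , c)

lvl : ∀ {d} → Order d → LinPoly d → ℕ
lvl rk f = proj₁ (lead rk f)

lc : ∀ {d} → Order d → LinPoly d → ℤ
lc rk f = proj₂ (lead rk f)

Spol : ∀ {d} → Order d → LinPoly d → LinPoly d → LinPoly d
Spol rk f g = (lc rk g • f) ⊖ (lc rk f • g)

data InM {d} (Φ : System d) (f : LinPoly d) : LinPoly d → Set where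
  base  : InM Φ f f
  scale : ∀ c {g} → InM Φ f g → InM Φ f (c • g)
  add   : ∀ {g h} → InM Φ f g → InM Φ f h → InM Φ f (g ⊕ h)
  rule  : ∀ {g h} b → (g , h) ∈ Φ → InM Φ f (b • g) → InM Φ f (b • h)

lincomb : ∀ {d} → List (ℤ × LinPoly d) → LinPoly d
lincomb = foldr (λ cg acc → (proj₁ cg • proj₂ cg) ⊕ acc) 0P

LinIndep : ∀ {d} → (LinPoly d → Set) → Set
LinIndep {d} S = (cgs : List (ℤ × LinPoly d)) →
  Unique (List.map proj₂ cgs) → All (λ cg → S (proj₂ cg)) cgs →
  lincomb cgs ≡ 0P → All (λ cg → proj₁ cg ≡ + 0) cgs

IsBasisOf : ∀ {d} → (LinPoly d → Set) → (LinPoly d → Set) → Set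
IsBasisOf {d} S N =
  (∀ g → S g → N g) × LinIndep S ×
  (∀ h → N h → Σ (List (ℤ × LinPoly d)) λ cgs →
      All (λ cg → S (proj₂ cg)) cgs × lincomb cgs ≡ h)

ElimProp : ∀ {d} → Order d → System d → Set
ElimProp {d} rk Φ =
  ∀ f → Any (λ c → PrimPartOf f (proj₁ c)) Φ → ∀ k → k ≤ d →
    let Sk = λ g → lvl rk g ≤ k × (f , g) ∈ Φ in
    IsBasisOf Sk (λ h → InM Φ f h × lvl rk h ≤ k)

data InΔ {d} (rk : Order d) (Φ : System d) (f : LinPoly d) : LinPoly d → Set where
  term : ∀ {t} → Term Φ t → InΔ rk Φ f t
  spol : ∀ {g h} → (f , g) ∈ Φ → InΔ rk Φ f h → lvl rk g ≡ lvl rk h →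
         InΔ rk Φ f (Spol rk g h)

InΔall : ∀ {d} → Order d → System d → LinPoly d → Set
InΔall rk Φ h = Σ _ λ f → Σ _ λ t → Term Φ t × PrimPartOf f t × InΔ rk Φ f h

SClos : ∀ {d} → Order d → (LinPoly d → Set) → LinPoly d → Set
SClos rk X h = X h ⊎ Σ _ λ f → Σ _ λ g → X f × X g × h ≡ Spol rk f g

MinLambda : ∀ {d} → System d → LinPoly d → LinPoly d → ℤ → Set
MinLambda Φ f g λ' = λ' ≢ + 0 × InM Φ f (λ' • g) ×
  (∀ μ → μ ≢ + 0 → InM Φ f (μ • g) → ∣ λ' ∣ ≤ ∣ μ ∣)

PP0 : ∀ {d} → Order d → System d → ℕ → Set
PP0 {d} rk Φ p = Prime p × (P1 ⊎ P2 ⊎ P3)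
  where
  SΔ = SClos rk (InΔall rk Φ)
  P1 = Σ (List (LinPoly d)) λ hs → Unique hs × All SΔ hs × p ≤ length hs
  P2 = Σ (LinPoly d) λ h → SΔ h × DividesNZEntry p h
  P3 = Σ (LinPoly d) λ f → Term Φ f × Primitive f × Σ (LinPoly d) λ g →
         InΔ rk Φ f g × Σ ℤ λ λ' → MinLambda Φ f g λ' × p ∣ ∣ λ' ∣

{-# OPTIONS --safe #-}
-- Every prime in question divides a number K! · ∏_{h ∈ L} ∏_a max(|a|, 1), with a ranging over the
-- coefficients and the constant of h, and a product of distinct primes dividing a number is at most
-- that number.  For ℙ(Φ) take K = m and L the left-hand sides.  For ℙ₀(Φ), the elimination property
-- makes the right-hand side g of f ∣ g at each level unique, so Δ_f(Φ) consists of 0, the terms and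
-- the chains of iterated S-polynomials starting at terms; each chain has length at most d and each
-- step multiplies the norm by at most 2‖Φ‖∞.  This yields a list L ⊇ S(Δ(Φ)) with |L| ≤ 8m⁴(d+2)²
-- and K = |L| for (P1) and (P2).  For (P3): either M_f(Φ) = ℤf and the minimal λ is ±1, or ±f is the
-- primitive part of a left-hand side; then reducing g along S-polynomials gives some μ g ∈ M_f(Φ)
-- with μ a product of leading coefficients of right-hand sides, and λ ∣ μ by minimality of λ.
module Submission where

open import Defs
open import Data.Nat as ℕ using (ℕ; zero; suc; _≤_; _<_; z≤n; s≤s; _*_; _+_; _^_; _!; _⊔_; ⌈_/2⌉)
import Data.Nat.Properties as ℕ
import Data.Nat.GCD as ℕ
import Data.Nat.Divisibility as ℕ
import Data.Nat.DivMod as ℕ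
open import Data.Integer as ℤ using (ℤ; +_; -[1+_]; ∣_∣)
import Data.Integer.Properties as ℤ
open import Data.Integer.Tactic.RingSolver using (solve-∀)
import Data.Nat.Tactic.RingSolver as ℕ-Solver
import Data.Integer.Divisibility.Signed as ZS
open import Data.Fin as Fin using (Fin; toℕ)
import Data.Fin.Properties as Fin
open import Data.Vec as Vec using (lookup)
import Data.Vec.Properties as Vec
import Data.List.Properties as List
open import Data.List as List using (List; []; _∷_; _++_; map; length; allFin; foldr; concatMap)
open import Data.List.Relation.Unary.Any as Any using (Any; here; there)
open import Data.List.Relation.Unary.All as All using (All; []; _∷_)
import Data.List.Relation.Unary.All.Properties as AllP
open import Data.List.Relation.Unary.All.Properties.Core using (¬Any⇒All¬)
open import Data.List.Relation.Unary.AllPairs using ([]; _∷_)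
open import Data.List.Relation.Unary.Unique.Propositional using (Unique)
open import Data.List.Membership.Propositional using (_∈_; find)
open import Data.Product as Product using (Σ; _×_; _,_; proj₁; proj₂)
open import Data.Sum as Sum using (_⊎_; inj₁; inj₂; [_,_]′)
open import Function using (_∘_)
open import Data.Empty using (⊥-elim)
open import Data.Maybe using (Maybe; just; nothing; maybe′)
open import Data.Nat.Primality using (Prime; ¬prime[0]; ¬prime[1]; euclidsLemma; prime⇒nonZero)
open import Data.Nat.Primality.Factorisation using (factorisationHasAllPrimeFactors)
open import Data.Nat.ListAction using (product)
open import Data.Nat.ListAction.Properties using (∈⇒∣product; product≢0)
open import Data.Nat.Logarithm using (⌈log₂_⌉)
open import Data.Nat.Logarithm.Core using (⌈log2⌉)
import Data.Nat.Induction as ℕ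
open import Induction.WellFounded using (Acc; acc)
open import Relation.Nullary using (¬_; yes; no; Dec; does)
open import Data.Bool using (true; false; if_then_else_; _∧_; not; T)
open import Data.Unit using (tt)
open import Data.List.Membership.Propositional.Properties
  using (∈-allFin; ∈-++⁺ˡ; ∈-++⁺ʳ; ∈-++⁻; ∈-map⁺; ∈-concat⁺′; ∈-concat⁻′;
         ∈-cartesianProductWith⁺; ∈-cartesianProductWith⁻)
open import Data.Vec.Membership.Propositional.Properties using (∈-lookup; ∈-toList⁺; ∈-toList⁻)
import Data.Vec.Relation.Unary.Any as VAny
import Data.Vec.Relation.Unary.Any.Properties as VAnyP
open import Relation.Binary.PropositionalEquality
open import Function.Definitions using (Injective)

private variable d : ℕ

coeff : LinPoly d → Fin d → ℤ
coeff f i = lookup (coef f) i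

entry : LinPoly d → Fin (suc d) → ℤ
entry f Fin.zero    = const f
entry f (Fin.suc i) = coeff f i

LinPoly-ext : {f g : LinPoly d} → (∀ j → entry f j ≡ entry g j) → f ≡ g
LinPoly-ext {f = lin a c} {lin b c'} eq = cong₂ lin coefs (eq Fin.zero)
  where
  coefs : a ≡ b
  coefs = trans (sym (Vec.tabulate∘lookup a))
                (trans (Vec.tabulate-cong (λ i → eq (Fin.suc i))) (Vec.tabulate∘lookup b))

coeff-⊕ : (f g : LinPoly d) (i : Fin d) → coeff (f ⊕ g) i ≡ coeff f i ℤ.+ coeff g i
coeff-⊕ f g i = Vec.lookup-zipWith ℤ._+_ i (coef f) (coef g)

coeff-• : (c : ℤ) (f : LinPoly d) (i : Fin d) → coeff (c • f) i ≡ c ℤ.* coeff f i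
coeff-• c f i = Vec.lookup-map i (c ℤ.*_) (coef f)

coeff-0P : (i : Fin d) → coeff (0P {d}) i ≡ + 0
coeff-0P i = Vec.lookup-replicate i (+ 0)

entry-⊕ : (f g : LinPoly d) (j : Fin (suc d)) → entry (f ⊕ g) j ≡ entry f j ℤ.+ entry g j
entry-⊕ f g Fin.zero    = refl
entry-⊕ f g (Fin.suc i) = coeff-⊕ f g i

entry-• : (c : ℤ) (f : LinPoly d) (j : Fin (suc d)) → entry (c • f) j ≡ c ℤ.* entry f j
entry-• c f Fin.zero    = refl
entry-• c f (Fin.suc i) = coeff-• c f i

entry-⊖ : (f g : LinPoly d) (j : Fin (suc d)) → entry (f ⊖ g) j ≡ entry f j ℤ.- entry g j
entry-⊖ f g j = trans (entry-⊕ f (-[1+ 0 ] • g) j)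
  (cong (λ x → entry f j ℤ.+ x) (trans (entry-• -[1+ 0 ] g j) (ℤ.-1*i≡-i _)))

entry-0P : (j : Fin (suc d)) → entry (0P {d}) j ≡ + 0
entry-0P Fin.zero    = refl
entry-0P (Fin.suc i) = coeff-0P i

entry∈entries : (f : LinPoly d) (j : Fin (suc d)) → entry f j ∈ entries f
entry∈entries f Fin.zero    = here refl
entry∈entries f (Fin.suc i) = there (∈-toList⁺ (∈-lookup i (coef f)))

⊕-comm : (f g : LinPoly d) → f ⊕ g ≡ g ⊕ f
⊕-comm f g = LinPoly-ext λ j → trans (entry-⊕ f g j) (trans (ℤ.+-comm (entry f j) _) (sym (entry-⊕ g f j)))

⊕-assoc : (f g h : LinPoly d) → (f ⊕ g) ⊕ h ≡ f ⊕ (g ⊕ h)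
⊕-assoc f g h = LinPoly-ext λ j → begin
  entry ((f ⊕ g) ⊕ h) j                    ≡⟨ trans (entry-⊕ (f ⊕ g) h j) (cong (λ x → x ℤ.+ entry h j) (entry-⊕ f g j)) ⟩
  entry f j ℤ.+ entry g j ℤ.+ entry h j    ≡⟨ ℤ.+-assoc (entry f j) _ _ ⟩
  entry f j ℤ.+ (entry g j ℤ.+ entry h j)
    ≡⟨ sym (trans (entry-⊕ f (g ⊕ h) j) (cong (λ x → entry f j ℤ.+ x) (entry-⊕ g h j))) ⟩
  entry (f ⊕ (g ⊕ h)) j                    ∎
  where open ≡-Reasoning

⊕-identityʳ : (f : LinPoly d) → f ⊕ 0P ≡ f
⊕-identityʳ f = LinPoly-ext λ j →
  trans (entry-⊕ f 0P j) (trans (cong (λ x → entry f j ℤ.+ x) (entry-0P j)) (ℤ.+-identityʳ _))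

•-assoc : (a b : ℤ) (f : LinPoly d) → a • (b • f) ≡ (a ℤ.* b) • f
•-assoc a b f = LinPoly-ext λ j →
  trans (entry-• a (b • f) j)
    (trans (cong (a ℤ.*_) (entry-• b f j)) (trans (sym (ℤ.*-assoc a b _)) (sym (entry-• (a ℤ.* b) f j))))

•-identityˡ : (f : LinPoly d) → (+ 1) • f ≡ f
•-identityˡ f = LinPoly-ext λ j → trans (entry-• (+ 1) f j) (ℤ.*-identityˡ _)

•-zeroˡ : (f : LinPoly d) → (+ 0) • f ≡ 0P
•-zeroˡ f = LinPoly-ext λ j → trans (entry-• (+ 0) f j) (sym (entry-0P j))

•-zeroʳ : (c : ℤ) → c • 0P {d} ≡ 0P
•-zeroʳ c = LinPoly-ext λ j →
  trans (entry-• c 0P j) (trans (cong (c ℤ.*_) (entry-0P j)) (trans (ℤ.*-zeroʳ c) (sym (entry-0P j))))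

•-distribˡ : (c : ℤ) (f g : LinPoly d) → c • (f ⊕ g) ≡ (c • f) ⊕ (c • g)
•-distribˡ c f g = LinPoly-ext λ j → begin
  entry (c • (f ⊕ g)) j                     ≡⟨ trans (entry-• c (f ⊕ g) j) (cong (c ℤ.*_) (entry-⊕ f g j)) ⟩
  c ℤ.* (entry f j ℤ.+ entry g j)           ≡⟨ ℤ.*-distribˡ-+ c (entry f j) _ ⟩
  c ℤ.* entry f j ℤ.+ c ℤ.* entry g j
    ≡⟨ sym (trans (entry-⊕ (c • f) (c • g) j) (cong₂ ℤ._+_ (entry-• c f j) (entry-• c g j))) ⟩
  entry ((c • f) ⊕ (c • g)) j               ∎
  where open ≡-Reasoning

•-distribʳ : (a b : ℤ) (f : LinPoly d) → (a • f) ⊕ (b • f) ≡ (a ℤ.+ b) • f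
•-distribʳ a b f = LinPoly-ext λ j → begin
  entry ((a • f) ⊕ (b • f)) j            ≡⟨ trans (entry-⊕ (a • f) (b • f) j) (cong₂ ℤ._+_ (entry-• a f j) (entry-• b f j)) ⟩
  a ℤ.* entry f j ℤ.+ b ℤ.* entry f j    ≡⟨ sym (ℤ.*-distribʳ-+ (entry f j) a b) ⟩
  (a ℤ.+ b) ℤ.* entry f j                ≡⟨ sym (entry-• (a ℤ.+ b) f j) ⟩
  entry ((a ℤ.+ b) • f) j                ∎
  where open ≡-Reasoning

•-cancelˡ : (c : ℤ) {f g : LinPoly d} → c ≢ + 0 → c • f ≡ c • g → f ≡ g
•-cancelˡ c {f} {g} c≢0 eq = LinPoly-ext λ j →
  ℤ.*-cancelˡ-≡ c _ _ {{ℤ.≢-nonZero c≢0}}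
    (trans (sym (entry-• c f j)) (trans (cong (λ h → entry h j) eq) (entry-• c g j)))

⊖-self : (f : LinPoly d) → f ⊖ f ≡ 0P
⊖-self f = LinPoly-ext λ j → trans (entry-⊖ f f j) (trans (ℤ.+-inverseʳ (entry f j)) (sym (entry-0P j)))

⊖-⊖-cancel : (f g : LinPoly d) → f ⊖ (f ⊖ g) ≡ g
⊖-⊖-cancel f g = LinPoly-ext λ j → begin
  entry (f ⊖ (f ⊖ g)) j                  ≡⟨ trans (entry-⊖ f (f ⊖ g) j) (cong (λ x → entry f j ℤ.- x) (entry-⊖ f g j)) ⟩
  entry f j ℤ.- (entry f j ℤ.- entry g j) ≡⟨ x-[x-y]≡y (entry f j) (entry g j) ⟩
  entry g j                              ∎
  where
  open ≡-Reasoning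
  x-[x-y]≡y : ∀ x y → x ℤ.- (x ℤ.- y) ≡ y
  x-[x-y]≡y = solve-∀

•-comm : (a b : ℤ) (f : LinPoly d) → a • (b • f) ≡ b • (a • f)
•-comm a b f = trans (•-assoc a b f) (trans (cong (_• f) (ℤ.*-comm a b)) (sym (•-assoc b a f)))

•-distrib-⊖ : (c : ℤ) (f g : LinPoly d) → c • (f ⊖ g) ≡ (c • f) ⊖ (c • g)
•-distrib-⊖ c f g = trans (•-distribˡ c f (-[1+ 0 ] • g)) (cong ((c • f) ⊕_) (•-comm c -[1+ 0 ] g))

•-distribʳ-⊖ : (a b : ℤ) (f : LinPoly d) → (a • f) ⊖ (b • f) ≡ (a ℤ.- b) • f
•-distribʳ-⊖ a b f = begin
  (a • f) ⊕ (-[1+ 0 ] • (b • f))    ≡⟨ cong ((a • f) ⊕_) (•-assoc -[1+ 0 ] b f) ⟩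
  (a • f) ⊕ ((-[1+ 0 ] ℤ.* b) • f)  ≡⟨ •-distribʳ a (-[1+ 0 ] ℤ.* b) f ⟩
  (a ℤ.+ -[1+ 0 ] ℤ.* b) • f        ≡⟨ cong (λ x → (a ℤ.+ x) • f) (ℤ.-1*i≡-i b) ⟩
  (a ℤ.- b) • f                     ∎
  where open ≡-Reasoning

-- Leading variables

private
  module Lead (rk : Order d) (f : LinPoly d) where
    step : Fin d → ℕ × ℤ → ℕ × ℤ
    step i (l , c) =
      if not (does (coeff f i ℤ.≟ + 0)) ∧ (l ℕ.<ᵇ suc (toℕ (rk i)))
      then (suc (toℕ (rk i)) , coeff f i)
      else (l , c)

    leadOf : List (Fin d) → ℕ × ℤ
    leadOf = foldr step (0 , const f)

    IsLead : ℕ × ℤ → Set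
    IsLead (l , c) = (l ≡ 0 × c ≡ const f) ⊎
      Σ (Fin d) λ i → coeff f i ≢ + 0 × l ≡ suc (toℕ (rk i)) × c ≡ coeff f i

    isLead : ∀ is → IsLead (leadOf is)
    isLead []       = inj₁ (refl , refl)
    isLead (i ∷ is) with leadOf is | isLead is
    ... | (l , c) | ih with coeff f i ℤ.≟ + 0
    ... | yes _ = ih
    ... | no c≢0 with l ℕ.<ᵇ suc (toℕ (rk i))
    ... | true  = inj₂ (i , c≢0 , refl , refl)
    ... | false = ih

    step-mono : ∀ i p → proj₁ p ≤ proj₁ (step i p)
    step-mono i (l , c) with coeff f i ℤ.≟ + 0
    ... | yes _ = ℕ.≤-refl
    ... | no _ with l ℕ.<ᵇ suc (toℕ (rk i)) in lt
    ... | true  = ℕ.<⇒≤ (ℕ.<ᵇ⇒< l _ (subst T (sym lt) tt))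
    ... | false = ℕ.≤-refl

    step-bound : ∀ i p → coeff f i ≢ + 0 → suc (toℕ (rk i)) ≤ proj₁ (step i p)
    step-bound i (l , c) c≢0 with coeff f i ℤ.≟ + 0
    ... | yes c≡0 = ⊥-elim (c≢0 c≡0)
    ... | no _ with l ℕ.<ᵇ suc (toℕ (rk i)) in lt
    ... | true  = ℕ.≤-refl
    ... | false = ℕ.≮⇒≥ (λ l< → subst T lt (ℕ.<⇒<ᵇ l<))

    leadOf-bound : ∀ is {i} → i ∈ is → coeff f i ≢ + 0 → suc (toℕ (rk i)) ≤ proj₁ (leadOf is)
    leadOf-bound (i ∷ is) (here refl) c≢0 = step-bound i (leadOf is) c≢0
    leadOf-bound (j ∷ is) (there i∈) c≢0  = ℕ.≤-trans (leadOf-bound is i∈ c≢0) (step-mono j (leadOf is))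

module _ (rk : Order d) where

  coeff≢0⇒rank<lvl : (f : LinPoly d) (i : Fin d) → coeff f i ≢ + 0 → toℕ (rk i) < lvl rk f
  coeff≢0⇒rank<lvl f i = Lead.leadOf-bound rk f (allFin _) (∈-allFin i)

  lvl≡0⇒lc≡const : (f : LinPoly d) → lvl rk f ≡ 0 → lc rk f ≡ const f
  lvl≡0⇒lc≡const f l≡0 with Lead.isLead rk f (allFin _)
  ... | inj₁ (_ , c≡) = c≡
  ... | inj₂ (_ , _ , l≡ , _) = ⊥-elim (ℕ.0≢1+n (trans (sym l≡0) l≡))

  lvl≡suc⇒lc : (f : LinPoly d) {r : ℕ} → lvl rk f ≡ suc r →
    Σ (Fin d) λ i → toℕ (rk i) ≡ r × coeff f i ≡ lc rk f × lc rk f ≢ + 0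
  lvl≡suc⇒lc f l≡ with Lead.isLead rk f (allFin _)
  ... | inj₁ (l≡0 , _) = ⊥-elim (ℕ.0≢1+n (trans (sym l≡0) l≡))
  ... | inj₂ (i , c≢0 , l≡' , c≡) = i , ℕ.suc-injective (trans (sym l≡') l≡) , sym c≡ , λ z → c≢0 (trans (sym c≡) z)

  vanishing⇒lvl≤ : (f : LinPoly d) (k : ℕ) → (∀ i → k ≤ toℕ (rk i) → coeff f i ≡ + 0) → lvl rk f ≤ k
  vanishing⇒lvl≤ f k vanish with Lead.isLead rk f (allFin _)
  ... | inj₁ (l≡0 , _) = subst (_≤ k) (sym l≡0) z≤n
  ... | inj₂ (i , c≢0 , l≡ , _) = subst (_≤ k) (sym l≡) (ℕ.≰⇒> (λ k≤ → c≢0 (vanish i k≤)))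

  lvl≤⇒vanishing : (f : LinPoly d) {k : ℕ} → lvl rk f ≤ k → ∀ i → k ≤ toℕ (rk i) → coeff f i ≡ + 0
  lvl≤⇒vanishing f l≤k i k≤ with coeff f i ℤ.≟ + 0
  ... | yes c≡0 = c≡0
  ... | no c≢0  = ⊥-elim (ℕ.<⇒≱ (ℕ.<-≤-trans (coeff≢0⇒rank<lvl f i c≢0) l≤k) k≤)

  lvl≤d : (f : LinPoly d) → lvl rk f ≤ d
  lvl≤d f = vanishing⇒lvl≤ f _ (λ i d≤ → ⊥-elim (ℕ.<⇒≱ (Fin.toℕ<n (rk i)) d≤))

  lc-entry : (f : LinPoly d) → Σ (Fin (suc d)) λ j → lc rk f ≡ entry f j
  lc-entry f with lvl rk f in l≡
  ... | zero  = Fin.zero , lvl≡0⇒lc≡const f l≡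
  ... | suc _ = let (i , _ , c≡ , _) = lvl≡suc⇒lc f l≡ in Fin.suc i , sym c≡

  entry-Spol : (g h : LinPoly d) (j : Fin (suc d)) →
    entry (Spol rk g h) j ≡ lc rk h ℤ.* entry g j ℤ.- lc rk g ℤ.* entry h j
  entry-Spol g h j = trans (entry-⊖ (lc rk h • g) (lc rk g • h) j)
    (cong₂ ℤ._-_ (entry-• (lc rk h) g j) (entry-• (lc rk g) h j))

  lvl-0P : lvl rk (0P {d}) ≡ 0
  lvl-0P = ℕ.n≤0⇒n≡0 (vanishing⇒lvl≤ 0P 0 (λ i _ → coeff-0P i))

  lvl-⊕ : (f g : LinPoly d) {k : ℕ} → lvl rk f ≤ k → lvl rk g ≤ k → lvl rk (f ⊕ g) ≤ k
  lvl-⊕ f g {k} f≤ g≤ = vanishing⇒lvl≤ (f ⊕ g) k λ i k≤ →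
    trans (coeff-⊕ f g i) (cong₂ ℤ._+_ (lvl≤⇒vanishing f f≤ i k≤) (lvl≤⇒vanishing g g≤ i k≤))

  lvl-• : (c : ℤ) (f : LinPoly d) {k : ℕ} → lvl rk f ≤ k → lvl rk (c • f) ≤ k
  lvl-• c f {k} f≤ = vanishing⇒lvl≤ (c • f) k λ i k≤ →
    trans (coeff-• c f i) (trans (cong (c ℤ.*_) (lvl≤⇒vanishing f f≤ i k≤)) (ℤ.*-zeroʳ c))

  lvl-⊖ : (f g : LinPoly d) {k : ℕ} → lvl rk f ≤ k → lvl rk g ≤ k → lvl rk (f ⊖ g) ≤ k
  lvl-⊖ f g f≤ g≤ = lvl-⊕ f (-[1+ 0 ] • g) f≤ (lvl-• -[1+ 0 ] g g≤)

  lvl≡0⇒≡0P : (f : LinPoly d) → lvl rk f ≡ 0 → const f ≡ + 0 → f ≡ 0P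
  lvl≡0⇒≡0P f l≡0 c≡0 = LinPoly-ext λ where
    Fin.zero    → c≡0
    (Fin.suc i) → trans (lvl≤⇒vanishing f (ℕ.≤-reflexive l≡0) i z≤n) (sym (coeff-0P i))

  Spol-lvl≡0 : (g h : LinPoly d) → lvl rk g ≡ 0 → lvl rk h ≡ 0 → Spol rk g h ≡ 0P
  Spol-lvl≡0 g h g≡0 h≡0 = lvl≡0⇒≡0P (Spol rk g h)
    (ℕ.n≤0⇒n≡0 (lvl-⊖ (lc rk h • g) (lc rk g • h)
      (lvl-• (lc rk h) g (ℕ.≤-reflexive g≡0)) (lvl-• (lc rk g) h (ℕ.≤-reflexive h≡0))))
    (begin
      const (Spol rk g h)                       ≡⟨ entry-Spol g h Fin.zero ⟩
      lc rk h ℤ.* const g ℤ.- lc rk g ℤ.* const h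
        ≡⟨ cong₂ (λ a b → a ℤ.* const g ℤ.- b ℤ.* const h) (lvl≡0⇒lc≡const h h≡0) (lvl≡0⇒lc≡const g g≡0) ⟩
      const h ℤ.* const g ℤ.- const g ℤ.* const h ≡⟨ cong (λ x → x ℤ.- const g ℤ.* const h) (ℤ.*-comm (const h) (const g)) ⟩
      const g ℤ.* const h ℤ.- const g ℤ.* const h ≡⟨ ℤ.+-inverseʳ (const g ℤ.* const h) ⟩
      + 0                                        ∎)
    where open ≡-Reasoning

  -- the two leading terms cancel: this is where injectivity of rk is needed
  Spol-lvl< : Injective _≡_ _≡_ rk → (g h : LinPoly d) {r : ℕ} → lvl rk g ≡ suc r → lvl rk h ≡ suc r →
              lvl rk (Spol rk g h) ≤ r
  Spol-lvl< rk-inj g h {r} g≡ h≡ = vanishing⇒lvl≤ (Spol rk g h) r vanish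
    where
    vanish : ∀ i → r ≤ toℕ (rk i) → coeff (Spol rk g h) i ≡ + 0
    vanish i r≤ with ℕ.m≤n⇒m<n∨m≡n r≤
    ... | inj₁ r< = begin
      coeff (Spol rk g h) i                            ≡⟨ entry-Spol g h (Fin.suc i) ⟩
      lc rk h ℤ.* coeff g i ℤ.- lc rk g ℤ.* coeff h i   ≡⟨ cong₂ (λ a b → lc rk h ℤ.* a ℤ.- lc rk g ℤ.* b)
                                                            (lvl≤⇒vanishing g (ℕ.≤-reflexive g≡) i r<)
                                                            (lvl≤⇒vanishing h (ℕ.≤-reflexive h≡) i r<) ⟩
      lc rk h ℤ.* + 0 ℤ.- lc rk g ℤ.* + 0               ≡⟨ cong₂ ℤ._-_ (ℤ.*-zeroʳ (lc rk h)) (ℤ.*-zeroʳ (lc rk g)) ⟩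
      + 0                                              ∎
      where open ≡-Reasoning
    ... | inj₂ r≡ with lvl≡suc⇒lc g g≡ | lvl≡suc⇒lc h h≡
    ... | (ig , rg , cg , _) | (ih , rh , ch , _) = begin
      coeff (Spol rk g h) i                            ≡⟨ entry-Spol g h (Fin.suc i) ⟩
      lc rk h ℤ.* coeff g i ℤ.- lc rk g ℤ.* coeff h i   ≡⟨ cong₂ (λ a b → lc rk h ℤ.* a ℤ.- lc rk g ℤ.* b)
                                                            (trans (cong (coeff g) (at-rank-r ig rg)) cg)
                                                            (trans (cong (coeff h) (at-rank-r ih rh)) ch) ⟩
      lc rk h ℤ.* lc rk g ℤ.- lc rk g ℤ.* lc rk h
        ≡⟨ cong (λ x → x ℤ.- lc rk g ℤ.* lc rk h) (ℤ.*-comm (lc rk h) (lc rk g)) ⟩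
      lc rk g ℤ.* lc rk h ℤ.- lc rk g ℤ.* lc rk h       ≡⟨ ℤ.+-inverseʳ (lc rk g ℤ.* lc rk h) ⟩
      + 0                                              ∎
      where
      open ≡-Reasoning
      at-rank-r : ∀ j → toℕ (rk j) ≡ r → i ≡ j
      at-rank-r j j≡ = rk-inj (Fin.toℕ-injective (trans (sym r≡) (sym j≡)))

  lvl-•≡ : (c : ℤ) (f : LinPoly d) → c ≢ + 0 → lvl rk (c • f) ≡ lvl rk f
  lvl-•≡ c f c≢0 = ℕ.≤-antisym (lvl-• c f ℕ.≤-refl) lvl≤
    where
    lvl≤ : lvl rk f ≤ lvl rk (c • f)
    lvl≤ with lvl rk f in l≡
    ... | zero  = z≤n
    ... | suc r = let (i , rk≡ , c≡ , lc≢0) = lvl≡suc⇒lc f l≡ in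
      subst (_≤ lvl rk (c • f)) (cong suc rk≡) (coeff≢0⇒rank<lvl (c • f) i λ ci≡0 →
        [ c≢0 , (λ fi≡0 → lc≢0 (trans (sym c≡) fi≡0)) ]′ (ℤ.i*j≡0⇒i≡0∨j≡0 c (trans (sym (coeff-• c f i)) ci≡0)))

  Spol-lvl-drop : Injective _≡_ _≡_ rk → (g h : LinPoly d) {n : ℕ} →
    lvl rk g ≡ lvl rk h → lvl rk h ≤ suc n → lvl rk (Spol rk g h) ≤ n
  Spol-lvl-drop rk-inj g h {n} g≡h h≤ with lvl rk h in h≡
  ... | zero  = subst (_≤ n) (sym (trans (cong (lvl rk) (Spol-lvl≡0 g h g≡h h≡)) lvl-0P)) z≤n
  ... | suc r = ℕ.≤-trans (Spol-lvl< rk-inj g h g≡h h≡) (ℕ.≤-pred h≤)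

-- Divisibility modules and linear combinations

module _ {Φ : System d} {f : LinPoly d} where

  InM-0P : InM Φ f 0P
  InM-0P = subst (InM Φ f) (•-zeroˡ f) (scale (+ 0) base)

  InM-⊖ : ∀ {g h} → InM Φ f g → InM Φ f h → InM Φ f (g ⊖ h)
  InM-⊖ g∈ h∈ = add g∈ (scale -[1+ 0 ] h∈)

  InM-Spol : (rk : Order d) → ∀ {g h} → InM Φ f g → InM Φ f h → InM Φ f (Spol rk g h)
  InM-Spol rk {g} {h} g∈ h∈ = InM-⊖ (scale (lc rk h) g∈) (scale (lc rk g) h∈)

  InM-lincomb : (cgs : List (ℤ × LinPoly d)) → All (λ cg → InM Φ f (proj₂ cg)) cgs → InM Φ f (lincomb cgs)
  InM-lincomb []              []           = InM-0P
  InM-lincomb ((c , g) ∷ cgs) (g∈ ∷ cgs∈) = add (scale c g∈) (InM-lincomb cgs cgs∈)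

InM-trans : {Φ : System d} {f f' h : LinPoly d} → InM Φ f' f → InM Φ f h → InM Φ f' h
InM-trans f∈ base           = f∈
InM-trans f∈ (scale c h∈)   = scale c (InM-trans f∈ h∈)
InM-trans f∈ (add g∈ h∈)    = add (InM-trans f∈ g∈) (InM-trans f∈ h∈)
InM-trans f∈ (rule b gh∈ h∈) = rule b gh∈ (InM-trans f∈ h∈)

lincomb-lvl : (rk : Order d) {k : ℕ} (cgs : List (ℤ × LinPoly d)) →
  All (λ cg → lvl rk (proj₂ cg) ≤ k) cgs → lvl rk (lincomb cgs) ≤ k
lincomb-lvl rk {k} []              []     = subst (_≤ k) (sym (lvl-0P rk)) z≤n
lincomb-lvl rk ((c , g) ∷ cgs) (g≤ ∷ cgs≤) = lvl-⊕ rk (c • g) _ (lvl-• rk c g g≤) (lincomb-lvl rk cgs cgs≤)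

lincomb-lvl< : (rk : Order d) {k : ℕ} (cgs : List (ℤ × LinPoly d)) →
  All (λ cg → lvl rk (proj₂ cg) < k) cgs → lincomb cgs ≢ 0P → lvl rk (lincomb cgs) < k
lincomb-lvl< rk []                        []         ≢0P = ⊥-elim (≢0P refl)
lincomb-lvl< rk {zero} (_ ∷ _) (() ∷ _) _
lincomb-lvl< rk {suc k} cgs@(_ ∷ _) cgs<k _ = s≤s (lincomb-lvl rk cgs (All.map ℕ.≤-pred cgs<k))

_≟_ : (f g : LinPoly d) → Dec (f ≡ g)
lin a c ≟ lin b c' with Vec.≡-dec ℤ._≟_ a b | c ℤ.≟ c'
... | yes refl | yes refl = yes refl
... | no a≢b   | _        = no λ { refl → a≢b refl }
... | _        | no c≢c'  = no λ { refl → c≢c' refl }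

insertTerm : ℤ × LinPoly d → List (ℤ × LinPoly d) → List (ℤ × LinPoly d)
insertTerm cg      []                = cg ∷ []
insertTerm (c , g) ((c' , g') ∷ cgs) with g ≟ g'
... | yes _ = (c ℤ.+ c' , g') ∷ cgs
... | no _  = (c' , g') ∷ insertTerm (c , g) cgs

collectTerms : List (ℤ × LinPoly d) → List (ℤ × LinPoly d)
collectTerms = foldr insertTerm []

lincomb-insertTerm : (c : ℤ) (g : LinPoly d) (cgs : List (ℤ × LinPoly d)) →
  lincomb (insertTerm (c , g) cgs) ≡ (c • g) ⊕ lincomb cgs
lincomb-insertTerm c g [] = refl
lincomb-insertTerm c g ((c' , g') ∷ cgs) with g ≟ g'
... | yes refl = trans (cong (_⊕ lincomb cgs) (sym (•-distribʳ c c' g))) (⊕-assoc (c • g) (c' • g) (lincomb cgs))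
... | no _     = begin
  (c' • g') ⊕ lincomb (insertTerm (c , g) cgs) ≡⟨ cong ((c' • g') ⊕_) (lincomb-insertTerm c g cgs) ⟩
  (c' • g') ⊕ ((c • g) ⊕ lincomb cgs)          ≡⟨ sym (⊕-assoc (c' • g') (c • g) (lincomb cgs)) ⟩
  ((c' • g') ⊕ (c • g)) ⊕ lincomb cgs          ≡⟨ cong (_⊕ lincomb cgs) (⊕-comm (c' • g') (c • g)) ⟩
  ((c • g) ⊕ (c' • g')) ⊕ lincomb cgs          ≡⟨ ⊕-assoc (c • g) (c' • g') (lincomb cgs) ⟩
  (c • g) ⊕ ((c' • g') ⊕ lincomb cgs)          ∎
  where open ≡-Reasoning

insertTerm-∈ : ∀ {x} (c : ℤ) (g : LinPoly d) (cgs : List (ℤ × LinPoly d)) →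
  x ∈ map proj₂ (insertTerm (c , g) cgs) → x ≡ g ⊎ x ∈ map proj₂ cgs
insertTerm-∈ c g [] (here x≡g) = inj₁ x≡g
insertTerm-∈ c g ((c' , g') ∷ cgs) x∈ with g ≟ g'
insertTerm-∈ c g ((c' , g') ∷ cgs) x∈          | yes _ = inj₂ x∈
insertTerm-∈ c g ((c' , g') ∷ cgs) (here x≡g') | no _  = inj₂ (here x≡g')
insertTerm-∈ c g ((c' , g') ∷ cgs) (there x∈)  | no _  = Sum.map₂ there (insertTerm-∈ c g cgs x∈)

insertTerm-unique : (c : ℤ) (g : LinPoly d) (cgs : List (ℤ × LinPoly d)) →
  Unique (map proj₂ cgs) → Unique (map proj₂ (insertTerm (c , g) cgs))
insertTerm-unique c g [] _ = [] ∷ []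
insertTerm-unique c g ((c' , g') ∷ cgs) (g'∉ ∷ u) with g ≟ g'
... | yes _   = g'∉ ∷ u
... | no g≢g' = All.tabulate distinct ∷ insertTerm-unique c g cgs u
  where
  distinct : ∀ {x} → x ∈ map proj₂ (insertTerm (c , g) cgs) → g' ≢ x
  distinct x∈ with insertTerm-∈ c g cgs x∈
  ... | inj₁ refl = λ g'≡g → g≢g' (sym g'≡g)
  ... | inj₂ x∈'  = All.lookup g'∉ x∈'

insertTerm-All : {P : LinPoly d → Set} (c : ℤ) (g : LinPoly d) (cgs : List (ℤ × LinPoly d)) →
  P g → All (P ∘ proj₂) cgs → All (P ∘ proj₂) (insertTerm (c , g) cgs)
insertTerm-All c g [] pg [] = pg ∷ []
insertTerm-All c g ((c' , g') ∷ cgs) pg (pg' ∷ ps) with g ≟ g'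
... | yes _ = pg' ∷ ps
... | no _  = pg' ∷ insertTerm-All c g cgs pg ps

lincomb-collectTerms : (cgs : List (ℤ × LinPoly d)) → lincomb (collectTerms cgs) ≡ lincomb cgs
lincomb-collectTerms []              = refl
lincomb-collectTerms ((c , g) ∷ cgs) =
  trans (lincomb-insertTerm c g (collectTerms cgs)) (cong ((c • g) ⊕_) (lincomb-collectTerms cgs))

collectTerms-unique : (cgs : List (ℤ × LinPoly d)) → Unique (map proj₂ (collectTerms cgs))
collectTerms-unique []              = []
collectTerms-unique ((c , g) ∷ cgs) = insertTerm-unique c g (collectTerms cgs) (collectTerms-unique cgs)

collectTerms-All : {P : LinPoly d → Set} (cgs : List (ℤ × LinPoly d)) →
  All (P ∘ proj₂) cgs → All (P ∘ proj₂) (collectTerms cgs)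
collectTerms-All []              []         = []
collectTerms-All ((c , g) ∷ cgs) (pg ∷ ps) = insertTerm-All c g (collectTerms cgs) pg (collectTerms-All cgs ps)

scaleTerms : ℤ → List (ℤ × LinPoly d) → List (ℤ × LinPoly d)
scaleTerms a = map λ (c , g) → (a ℤ.* c , g)

lincomb-scaleTerms : (a : ℤ) (cgs : List (ℤ × LinPoly d)) → lincomb (scaleTerms a cgs) ≡ a • lincomb cgs
lincomb-scaleTerms a []              = sym (•-zeroʳ a)
lincomb-scaleTerms a ((c , g) ∷ cgs) =
  trans (cong₂ _⊕_ (sym (•-assoc a c g)) (lincomb-scaleTerms a cgs)) (sym (•-distribˡ a (c • g) (lincomb cgs)))

scaleTerms-polys : (a : ℤ) (cgs : List (ℤ × LinPoly d)) → map proj₂ (scaleTerms a cgs) ≡ map proj₂ cgs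
scaleTerms-polys a []       = refl
scaleTerms-polys a (_ ∷ cgs) = cong (_ ∷_) (scaleTerms-polys a cgs)

-- Primitive parts

private
  gcdL : List ℤ → ℕ
  gcdL = foldr (λ a acc → ℕ.gcd ∣ a ∣ acc) 0

  gcdL-scale : (c : ℤ) (as : List ℤ) → gcdL (map (c ℤ.*_) as) ≡ ∣ c ∣ * gcdL as
  gcdL-scale c []       = sym (ℕ.*-zeroʳ ∣ c ∣)
  gcdL-scale c (a ∷ as) = trans (cong₂ ℕ.gcd (ℤ.abs-* c a) (gcdL-scale c as))
    (sym (ℕ.c*gcd[m,n]≡gcd[cm,cn] ∣ c ∣ ∣ a ∣ (gcdL as)))

gcdP-• : (c : ℤ) (f : LinPoly d) → gcdP (c • f) ≡ ∣ c ∣ * gcdP f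
gcdP-• c f = trans (cong (λ as → gcdL (c ℤ.* const f ∷ as)) (Vec.toList-map (c ℤ.*_) (coef f)))
  (gcdL-scale c (entries f))

primitive-neg : {f : LinPoly d} → Primitive f → Primitive (-[1+ 0 ] • f)
primitive-neg {f = f} (f≢0 , gcd≡1) = -f≢0 , trans (gcdP-• -[1+ 0 ] f) (trans (ℕ.*-identityˡ (gcdP f)) gcd≡1)
  where
  -f≢0 : -[1+ 0 ] • f ≢ 0P
  -f≢0 -f≡0 = f≢0 (begin
    f                             ≡⟨ sym (•-identityˡ f) ⟩
    (+ 1) • f                     ≡⟨ sym (•-assoc -[1+ 0 ] -[1+ 0 ] f) ⟩
    -[1+ 0 ] • (-[1+ 0 ] • f)     ≡⟨ cong (-[1+ 0 ] •_) -f≡0 ⟩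
    -[1+ 0 ] • 0P                 ≡⟨ •-zeroʳ -[1+ 0 ] ⟩
    0P                            ∎)
    where open ≡-Reasoning

•-primitive-∣ : (c n : ℤ) {u f : LinPoly d} → c • u ≡ n • f → gcdP f ≡ 1 → ∣ c ∣ ℕ.∣ ∣ n ∣
•-primitive-∣ c n {u} {f} eq gcd≡1 = ℕ.divides (gcdP u) (begin
  ∣ n ∣                 ≡⟨ sym (ℕ.*-identityʳ ∣ n ∣) ⟩
  ∣ n ∣ * 1             ≡⟨ cong (∣ n ∣ *_) (sym gcd≡1) ⟩
  ∣ n ∣ * gcdP f        ≡⟨ sym (gcdP-• n f) ⟩
  gcdP (n • f)          ≡⟨ cong gcdP (sym eq) ⟩
  gcdP (c • u)          ≡⟨ gcdP-• c u ⟩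
  ∣ c ∣ * gcdP u        ≡⟨ ℕ.*-comm ∣ c ∣ (gcdP u) ⟩
  gcdP u * ∣ c ∣        ∎)
  where open ≡-Reasoning

∣i∣≡∣j∣⇒i≡±j : {i j : ℤ} → ∣ i ∣ ≡ ∣ j ∣ → i ≡ j ⊎ i ≡ ℤ.- j
∣i∣≡∣j∣⇒i≡±j {+ m}      {+ n}      refl = inj₁ refl
∣i∣≡∣j∣⇒i≡±j {+ m}      { -[1+ n ]} refl = inj₂ refl
∣i∣≡∣j∣⇒i≡±j { -[1+ m ]} {+ n}      refl = inj₂ refl
∣i∣≡∣j∣⇒i≡±j { -[1+ m ]} { -[1+ n ]} refl = inj₁ refl

LhsPrimPart : System d → LinPoly d → Set
LhsPrimPart Φ f = Any (λ c → PrimPartOf f (proj₁ c)) Φ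

lhs-Term : {Φ : System d} {c : LinPoly d × LinPoly d} → c ∈ Φ → Term Φ (proj₁ c)
lhs-Term = Any.map λ { refl → inj₁ refl }

rhs-Term : {Φ : System d} {f g : LinPoly d} → (f , g) ∈ Φ → Term Φ g
rhs-Term = Any.map λ { refl → inj₂ refl }

lhs-self : {Φ : System d} → WellFormed Φ → ∀ {f g} → (f , g) ∈ Φ → Primitive f → LhsPrimPart Φ f
lhs-self wf {f} fg∈ pf = Any.map (λ { refl → All.lookup wf fg∈ , pf , f≡1f }) fg∈
  where
  f≡1f : f ≡ (+ gcdP f) • f
  f≡1f = sym (trans (cong (λ n → (+ n) • f) (proj₂ pf)) (•-identityˡ f))

primPart-of-multiple : {f g : LinPoly d} (b n : ℤ) → Primitive f → g ≢ 0P → b ≢ + 0 → b • g ≡ n • f →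
  PrimPartOf f g ⊎ PrimPartOf (-[1+ 0 ] • f) g
primPart-of-multiple {f = f} {g} b n pf g≢0 b≢0 bg≡nf with ∣i∣≡∣j∣⇒i≡±j {n} {b ℤ.* + G} ∣n∣≡∣bG∣
  where
  G = gcdP g
  ∣n∣≡∣bG∣ : ∣ n ∣ ≡ ∣ b ℤ.* + G ∣
  ∣n∣≡∣bG∣ = trans (sym (trans (gcdP-• n f) (trans (cong (∣ n ∣ *_) (proj₂ pf)) (ℕ.*-identityʳ ∣ n ∣))))
             (trans (cong gcdP (sym bg≡nf)) (trans (gcdP-• b g) (sym (ℤ.abs-* b (+ G)))))
... | inj₁ n≡bG = inj₁ (g≢0 , pf , •-cancelˡ b b≢0 (begin
  b • g                 ≡⟨ bg≡nf ⟩
  n • f                 ≡⟨ cong (_• f) n≡bG ⟩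
  (b ℤ.* + gcdP g) • f  ≡⟨ sym (•-assoc b (+ gcdP g) f) ⟩
  b • ((+ gcdP g) • f)    ∎))
  where open ≡-Reasoning
... | inj₂ n≡-bG = inj₂ (g≢0 , primitive-neg pf , •-cancelˡ b b≢0 (begin
  b • g                                   ≡⟨ bg≡nf ⟩
  n • f                                   ≡⟨ cong (_• f) (trans n≡-bG (-[xy]≡x[y*-1] b (+ gcdP g))) ⟩
  (b ℤ.* (+ gcdP g ℤ.* -[1+ 0 ])) • f     ≡⟨ sym (trans (cong (b •_) (•-assoc (+ gcdP g) -[1+ 0 ] f)) (•-assoc b _ f)) ⟩
  b • ((+ gcdP g) • (-[1+ 0 ] • f))         ∎))
  where
  open ≡-Reasoning
  -[xy]≡x[y*-1] : ∀ x y → ℤ.- (x ℤ.* y) ≡ x ℤ.* (y ℤ.* -[1+ 0 ])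
  -[xy]≡x[y*-1] = solve-∀

InM-multiples : {Φ : System d} {f : LinPoly d} → WellFormed Φ → Primitive f → ∀ {h} → InM Φ f h →
  (Σ ℤ λ n → h ≡ n • f) ⊎ (LhsPrimPart Φ f ⊎ LhsPrimPart Φ (-[1+ 0 ] • f))
InM-multiples {f = f} wf pf base = inj₁ (+ 1 , sym (•-identityˡ f))
InM-multiples {f = f} wf pf (scale c h∈) with InM-multiples wf pf h∈
... | inj₁ (n , refl) = inj₁ (c ℤ.* n , •-assoc c n f)
... | inj₂ lhs        = inj₂ lhs
InM-multiples {f = f} wf pf (add g∈ h∈) with InM-multiples wf pf g∈ | InM-multiples wf pf h∈
... | inj₁ (n , refl) | inj₁ (n' , refl) = inj₁ (n ℤ.+ n' , •-distribʳ n n' f)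
... | inj₂ lhs        | _                = inj₂ lhs
... | inj₁ _          | inj₂ lhs         = inj₂ lhs
InM-multiples {f = f} wf pf (rule {g} {h} b gh∈ bg∈) with InM-multiples wf pf bg∈
... | inj₂ lhs = inj₂ lhs
... | inj₁ (n , bg≡nf) with b ℤ.≟ + 0
... | yes refl = inj₁ (+ 0 , trans (•-zeroˡ h) (sym (•-zeroˡ f)))
... | no b≢0   = inj₂ (Sum.map lhsOf lhsOf (primPart-of-multiple b n pf (All.lookup wf gh∈) b≢0 bg≡nf))
  where
  lhsOf : ∀ {e} → PrimPartOf e g → LhsPrimPart _ e
  lhsOf pp = Any.map (λ { refl → pp }) gh∈

TermPrime : System d → ℕ → Set
TermPrime {d} Φ p = Σ (LinPoly d) λ t → Term Φ t × DividesNZEntry p t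

TermSmooth : System d → ℤ → Set
TermSmooth Φ μ = ∀ {p} → Prime p → p ℕ.∣ ∣ μ ∣ → TermPrime Φ p

module _ {Φ : System d} where

  smooth-1 : TermSmooth Φ (+ 1)
  smooth-1 pp p∣1 = ⊥-elim (¬prime[1] (subst Prime (ℕ.∣1⇒≡1 p∣1) pp))

  smooth-* : ∀ {μ ν} → TermSmooth Φ μ → TermSmooth Φ ν → TermSmooth Φ (μ ℤ.* ν)
  smooth-* {μ} {ν} μ-smooth ν-smooth pp p∣ =
    [ μ-smooth pp , ν-smooth pp ]′ (euclidsLemma ∣ μ ∣ ∣ ν ∣ pp (subst (_ ℕ.∣_) (ℤ.abs-* μ ν) p∣))

  smooth-lc : (rk : Order d) {t : LinPoly d} → Term Φ t → lc rk t ≢ + 0 → TermSmooth Φ (lc rk t)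
  smooth-lc rk {t} t∈ lc≢0 pp p∣ = let (j , lc≡) = lc-entry rk t in
    t , t∈ , Any.map (λ { refl → lc≢0 , p∣ }) (subst (_∈ entries t) (sym lc≡) (entry∈entries t j))

-- Consequences of the elimination property

module Elimination (rk : Order d) (rk-inj : Injective _≡_ _≡_ rk) {Φ : System d} (ep : ElimProp rk Φ)
                   {f : LinPoly d} (f-lhs : LhsPrimPart Φ f) where

  Basis : ℕ → LinPoly d → Set
  Basis k g = lvl rk g ≤ k × (f , g) ∈ Φ

  basis : ∀ k → k ≤ d → IsBasisOf (Basis k) (λ h → InM Φ f h × lvl rk h ≤ k)
  basis = ep f f-lhs

  rhs∈M : ∀ {g} → (f , g) ∈ Φ → InM Φ f g
  rhs∈M {g} fg∈ = proj₁ (proj₁ (basis d ℕ.≤-refl) g (lvl≤d rk g , fg∈))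

  rhs≢0P : ∀ {g} → (f , g) ∈ Φ → g ≢ 0P
  rhs≢0P fg∈ refl with proj₁ (proj₂ (basis 0 z≤n)) ((+ 1 , 0P) ∷ []) ([] ∷ [])
                          ((ℕ.≤-reflexive (lvl-0P rk) , fg∈) ∷ []) (trans (⊕-identityʳ _) (•-zeroʳ (+ 1)))
  ... | () ∷ []

  lc-rhs≢0 : ∀ {g} → (f , g) ∈ Φ → lc rk g ≢ + 0
  lc-rhs≢0 {g} fg∈ with lvl rk g in l≡
  ... | zero  = λ lc≡0 → rhs≢0P fg∈ (lvl≡0⇒≡0P rk g l≡ (trans (sym (lvl≡0⇒lc≡const rk g l≡)) lc≡0))
  ... | suc _ = proj₂ (proj₂ (proj₂ (lvl≡suc⇒lc rk g l≡)))

  Spol-rhs-below : ∀ {g₁ g₂ k} → (f , g₁) ∈ Φ → (f , g₂) ∈ Φ → lvl rk g₁ ≡ k → lvl rk g₂ ≡ k →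
    Σ (List (ℤ × LinPoly d)) λ cgs →
      All (λ cg → lvl rk (proj₂ cg) < k × (f , proj₂ cg) ∈ Φ) cgs × lincomb cgs ≡ Spol rk g₁ g₂
  Spol-rhs-below {g₁} {g₂} {zero} _ _ g₁≡ g₂≡ = [] , [] , sym (Spol-lvl≡0 rk g₁ g₂ g₁≡ g₂≡)
  Spol-rhs-below {g₁} {g₂} {suc r} g₁∈ g₂∈ g₁≡ g₂≡ =
    let r≤d = ℕ.≤-trans (ℕ.n≤1+n r) (subst (_≤ d) g₁≡ (lvl≤d rk g₁))
        (cgs , cgs∈ , cgs≡) = proj₂ (proj₂ (basis r r≤d)) (Spol rk g₁ g₂)
                                (InM-Spol rk (rhs∈M g₁∈) (rhs∈M g₂∈) , Spol-lvl< rk rk-inj g₁ g₂ g₁≡ g₂≡)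
    in cgs , All.map (λ (l≤ , fg∈) → s≤s l≤ , fg∈) cgs∈ , cgs≡

  -- the S-polynomial of two distinct such right-hand sides would give a non-trivial relation
  rhs-unique : ∀ {g₁ g₂} → (f , g₁) ∈ Φ → (f , g₂) ∈ Φ → lvl rk g₁ ≡ lvl rk g₂ → g₁ ≡ g₂
  rhs-unique {g₁} {g₂} g₁∈ g₂∈ l≡ with g₁ ≟ g₂
  ... | yes g₁≡g₂ = g₁≡g₂
  ... | no g₁≢g₂ with Spol-rhs-below g₁∈ g₂∈ refl (sym l≡)
  ... | cgs , cgs-below , cgs≡ = ⊥-elim (lc-rhs≢0 g₂∈ (head-coefficient (independent L distinct L-basis L≡0P)))
    where
    k = lvl rk g₁
    C = collectTerms cgs
    L = (lc rk g₂ , g₁) ∷ (-[1+ 0 ] ℤ.* lc rk g₁ , g₂) ∷ scaleTerms -[1+ 0 ] C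
    independent = proj₁ (proj₂ (basis k (lvl≤d rk g₁)))
    C-below = collectTerms-All cgs cgs-below
    C-avoids : ∀ {g} → lvl rk g ≡ k → All (g ≢_) (map proj₂ (scaleTerms -[1+ 0 ] C))
    C-avoids g≡ = AllP.map⁺ (AllP.map⁺ (All.map (λ (l< , _) g≡x → ℕ.<-irrefl refl
                    (subst (_< k) (trans (cong (lvl rk) (sym g≡x)) g≡) l<)) C-below))
    distinct : Unique (map proj₂ L)
    distinct = (g₁≢g₂ ∷ C-avoids refl) ∷ C-avoids (sym l≡)
             ∷ subst Unique (sym (scaleTerms-polys -[1+ 0 ] C)) (collectTerms-unique cgs)
    L-basis : All (λ cg → Basis k (proj₂ cg)) L
    L-basis = (ℕ.≤-refl , g₁∈) ∷ (ℕ.≤-reflexive (sym l≡) , g₂∈)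
            ∷ AllP.map⁺ (All.map (λ (l< , fg∈) → ℕ.<⇒≤ l< , fg∈) C-below)
    L≡0P : lincomb L ≡ 0P
    L≡0P = begin
      (lc rk g₂ • g₁) ⊕ (((-[1+ 0 ] ℤ.* lc rk g₁) • g₂) ⊕ lincomb (scaleTerms -[1+ 0 ] C))
        ≡⟨ cong₂ (λ x y → (lc rk g₂ • g₁) ⊕ (x ⊕ y)) (sym (•-assoc -[1+ 0 ] (lc rk g₁) g₂)) (lincomb-scaleTerms -[1+ 0 ] C) ⟩
      (lc rk g₂ • g₁) ⊕ ((-[1+ 0 ] • (lc rk g₁ • g₂)) ⊕ (-[1+ 0 ] • lincomb C))
        ≡⟨ sym (⊕-assoc (lc rk g₂ • g₁) _ _) ⟩
      Spol rk g₁ g₂ ⊖ lincomb C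
        ≡⟨ cong (Spol rk g₁ g₂ ⊖_) (trans (lincomb-collectTerms cgs) cgs≡) ⟩
      Spol rk g₁ g₂ ⊖ Spol rk g₁ g₂
        ≡⟨ ⊖-self (Spol rk g₁ g₂) ⟩
      0P ∎
      where open ≡-Reasoning
    head-coefficient : All (λ cg → proj₁ cg ≡ + 0) L → lc rk g₂ ≡ + 0
    head-coefficient (c≡0 ∷ _) = c≡0

  -- otherwise λ' u would be a combination of basis elements of lower level
  rhs-at-lvl : ∀ {u} λ' → λ' ≢ + 0 → u ≢ 0P → InM Φ f (λ' • u) →
    Σ (LinPoly d) λ b → (f , b) ∈ Φ × lvl rk b ≡ lvl rk u
  rhs-at-lvl {u} λ' λ'≢0 u≢0 λu∈
    with proj₂ (proj₂ (basis (lvl rk u) (lvl≤d rk u))) (λ' • u) (λu∈ , lvl-• rk λ' u ℕ.≤-refl)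
  ... | cgs , cgs∈ , cgs≡ with Any.any? (λ cg → lvl rk (proj₂ cg) ℕ.≟ lvl rk u) cgs
  ... | yes found = let (cg , cg∈ , l≡) = find found in proj₂ cg , proj₂ (All.lookup cgs∈ cg∈) , l≡
  ... | no none = ⊥-elim (ℕ.<-irrefl (lvl-•≡ rk λ' u λ'≢0)
                    (subst (λ v → lvl rk v < lvl rk u) cgs≡ (lincomb-lvl< rk cgs cgs<u cgs≢0P)))
    where
    cgs<u : All (λ cg → lvl rk (proj₂ cg) < lvl rk u) cgs
    cgs<u = All.zipWith (λ ((l≤ , _) , l≢) → ℕ.≤∧≢⇒< l≤ l≢) (cgs∈ , ¬Any⇒All¬ cgs none)
    cgs≢0P : lincomb cgs ≢ 0P
    cgs≢0P cgs≡0 = u≢0 (•-cancelˡ λ' λ'≢0 (trans (sym cgs≡) (trans cgs≡0 (sym (•-zeroʳ λ')))))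

  Spol-step : ∀ {b u} λ' → (f , b) ∈ Φ → InM Φ f (λ' • u) → InM Φ f (λ' • Spol rk b u)
  Spol-step {b} {u} λ' fb∈ λu∈ = subst (InM Φ f) (sym (•-distrib-⊖ λ' (lc rk u • b) (lc rk b • u)))
    (InM-⊖ (scale λ' (scale (lc rk u) (rhs∈M fb∈))) (subst (InM Φ f) (•-comm (lc rk b) λ' u) (scale (lc rk b) λu∈)))

  Spol-lift : ∀ {b u} → (f , b) ∈ Φ → Σ ℤ (λ μ → TermSmooth Φ μ × InM Φ f (μ • Spol rk b u)) →
    Σ ℤ λ μ → TermSmooth Φ μ × InM Φ f (μ • u)
  Spol-lift {b} {u} fb∈ (μ , μ-smooth , μS∈) =
    μ ℤ.* lc rk b , smooth-* {μ = μ} {ν = lc rk b} μ-smooth (smooth-lc rk (rhs-Term fb∈) (lc-rhs≢0 fb∈)) ,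
    subst (InM Φ f) μlc•u≡ (InM-⊖ (scale μ (scale (lc rk u) (rhs∈M fb∈))) (subst (InM Φ f) (•-distrib-⊖ μ _ _) μS∈))
    where
    μlc•u≡ : (μ • (lc rk u • b)) ⊖ ((μ • (lc rk u • b)) ⊖ (μ • (lc rk b • u))) ≡ (μ ℤ.* lc rk b) • u
    μlc•u≡ = trans (⊖-⊖-cancel (μ • (lc rk u • b)) (μ • (lc rk b • u))) (•-assoc μ (lc rk b) u)

  smooth-0P : ∀ {u} → u ≡ 0P → Σ ℤ λ μ → TermSmooth Φ μ × InM Φ f (μ • u)
  smooth-0P refl = + 1 , smooth-1 , subst (InM Φ f) (sym (•-zeroʳ (+ 1))) InM-0P

  -- reduce u along S-polynomials; μ collects the leading coefficients of the right-hand sides used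
  smooth-multiple : ∀ n {u} → lvl rk u ≤ n → ∀ λ' → λ' ≢ + 0 → InM Φ f (λ' • u) →
    Σ ℤ λ μ → TermSmooth Φ μ × InM Φ f (μ • u)
  smooth-multiple n {u} u≤n λ' λ'≢0 λu∈ with u ≟ 0P
  ... | yes u≡0 = smooth-0P u≡0
  ... | no u≢0 with rhs-at-lvl λ' λ'≢0 u≢0 λu∈
  ... | b , fb∈ , b≡u = Spol-lift fb∈ (reduce n u≤n)
    where
    reduce : ∀ m → lvl rk u ≤ m → Σ ℤ λ μ → TermSmooth Φ μ × InM Φ f (μ • Spol rk b u)
    reduce zero    u≤0 = let u≡0 = ℕ.n≤0⇒n≡0 u≤0 in smooth-0P (Spol-lvl≡0 rk b u (trans b≡u u≡0) u≡0)
    reduce (suc m) u≤  = smooth-multiple m (Spol-lvl-drop rk rk-inj b u b≡u u≤) λ' λ'≢0 (Spol-step λ' fb∈ λu∈)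

-- Minimal multiples

InM-abs : {Φ : System d} {f g : LinPoly d} (x : ℤ) → InM Φ f (x • g) → InM Φ f ((+ ∣ x ∣) • g)
InM-abs (+ n)      xg∈ = xg∈
InM-abs {Φ = Φ} {f} {g} -[1+ n ] xg∈ =
  subst (InM Φ f) (trans (•-assoc -[1+ 0 ] -[1+ n ] g) (cong (_• g) (ℤ.-1*i≡-i -[1+ n ]))) (scale -[1+ 0 ] xg∈)

-- Euclidean division: the remainder is again a multiple, and smaller than the minimal one
minLambda-∣ : {Φ : System d} {f g : LinPoly d} {λ' : ℤ} → MinLambda Φ f g λ' →
  (μ : ℤ) → InM Φ f (μ • g) → ∣ λ' ∣ ℕ.∣ ∣ μ ∣
minLambda-∣ {Φ = Φ} {f} {g} {λ'} (λ'≢0 , λg∈ , minimal) μ μg∈ = ℕ.m%n≡0⇒n∣m m a r≡0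
  where
  a = ∣ λ' ∣
  m = ∣ μ ∣
  instance
    a≢0 : ℕ.NonZero a
    a≢0 = ℕ.≢-nonZero (λ'≢0 ∘ ℤ.∣i∣≡0⇒i≡0)
  r = m ℕ.% a
  q = m ℕ./ a
  scalar : + m ℤ.- (+ q) ℤ.* (+ a) ≡ + r
  scalar = begin
    + m ℤ.- (+ q) ℤ.* (+ a)                ≡⟨ cong (λ x → + x ℤ.- (+ q) ℤ.* (+ a)) (ℕ.m≡m%n+[m/n]*n m a) ⟩
    + (r + q * a) ℤ.- (+ q) ℤ.* (+ a)
      ≡⟨ cong (λ x → x ℤ.- (+ q) ℤ.* (+ a)) (trans (ℤ.pos-+ r (q * a)) (cong (λ x → + r ℤ.+ x) (ℤ.pos-* q a))) ⟩
    + r ℤ.+ (+ q) ℤ.* (+ a) ℤ.- (+ q) ℤ.* (+ a) ≡⟨ [x+y]-y≡x (+ r) ((+ q) ℤ.* (+ a)) ⟩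
    + r                                     ∎
    where
    open ≡-Reasoning
    [x+y]-y≡x : ∀ x y → x ℤ.+ y ℤ.- y ≡ x
    [x+y]-y≡x = solve-∀
  rg∈ : InM Φ f ((+ r) • g)
  rg∈ = subst (InM Φ f)
          (trans (cong (λ h → ((+ m) • g) ⊖ h) (•-assoc (+ q) (+ a) g))
                 (trans (•-distribʳ-⊖ (+ m) ((+ q) ℤ.* (+ a)) g) (cong (_• g) scalar)))
          (InM-⊖ (InM-abs μ μg∈) (scale (+ q) (InM-abs λ' λg∈)))
  r≡0 : r ≡ 0
  r≡0 with r ℕ.≟ 0
  ... | yes r≡0 = r≡0
  ... | no r≢0  = ⊥-elim (ℕ.<⇒≱ (ℕ.m%n<n m a) (minimal (+ r) (r≢0 ∘ ℤ.+-injective) rg∈))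

minLambda-TermPrime : (rk : Order d) → Injective _≡_ _≡_ rk → {Φ : System d} → WellFormed Φ → ElimProp rk Φ →
  {f g : LinPoly d} {λ' : ℤ} → Primitive f → MinLambda Φ f g λ' →
  ∀ {p} → Prime p → p ℕ.∣ ∣ λ' ∣ → TermPrime Φ p
minLambda-TermPrime rk rk-inj {Φ} wf ep {f} {g} {λ'} pf ml@(λ'≢0 , λg∈ , _) pp p∣λ'
  with InM-multiples wf pf λg∈
... | inj₁ (n , λg≡nf) = ⊥-elim (¬prime[1] (subst Prime (ℕ.∣1⇒≡1 (ℕ.∣-trans p∣λ' (minLambda-∣ ml (+ 1) g∈))) pp))
  where
  g∈ : InM Φ f ((+ 1) • g)
  g∈ with ZS.∣ᵤ⇒∣ {λ'} {n} (•-primitive-∣ λ' n {g} {f} λg≡nf (proj₂ pf))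
  ... | ZS.divides q n≡qλ' = subst (InM Φ f) (trans (sym g≡qf) (sym (•-identityˡ g))) (scale q base)
    where
    g≡qf : g ≡ q • f
    g≡qf = •-cancelˡ λ' λ'≢0 (trans λg≡nf (trans (cong (_• f) (trans n≡qλ' (ℤ.*-comm q λ'))) (sym (•-assoc λ' q f))))
... | inj₂ (inj₁ f-lhs) =
  let (μ , μ-smooth , μg∈) = Elimination.smooth-multiple rk rk-inj ep f-lhs (lvl rk g) ℕ.≤-refl λ' λ'≢0 λg∈
  in μ-smooth pp (ℕ.∣-trans p∣λ' (minLambda-∣ ml μ μg∈))
... | inj₂ (inj₂ -f-lhs) =
  let (μ , μ-smooth , μg∈) = Elimination.smooth-multiple rk rk-inj ep -f-lhs (lvl rk g) ℕ.≤-refl λ' λ'≢0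
                               (InM-trans f∈M₋f λg∈)
  in μ-smooth pp (ℕ.∣-trans p∣λ' (minLambda-∣ ml μ (InM-trans (scale -[1+ 0 ] base) μg∈)))
  where
  f∈M₋f : InM Φ (-[1+ 0 ] • f) f
  f∈M₋f = subst (InM Φ _) (trans (•-assoc -[1+ 0 ] -[1+ 0 ] f) (•-identityˡ f)) (scale -[1+ 0 ] base)

entries⇒entry : {f : LinPoly d} {a : ℤ} → a ∈ entries f → Σ (Fin (suc d)) λ j → a ≡ entry f j
entries⇒entry (here a≡)  = Fin.zero , a≡
entries⇒entry (there a∈) = let a∈v = ∈-toList⁻ a∈ in Fin.suc (VAny.index a∈v) , VAnyP.lookup-index a∈v

private
  maxAbs : List ℤ → ℕ
  maxAbs = foldr (λ a acc → ∣ a ∣ ⊔ acc) 0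

  ≤maxAbs : ∀ {a} as → a ∈ as → ∣ a ∣ ≤ maxAbs as
  ≤maxAbs (a ∷ as) (here refl) = ℕ.m≤m⊔n ∣ a ∣ (maxAbs as)
  ≤maxAbs (b ∷ as) (there a∈)  = ℕ.m≤n⇒m≤o⊔n ∣ b ∣ (≤maxAbs as a∈)

  maxAbs≤ : ∀ {B} as → All (λ a → ∣ a ∣ ≤ B) as → maxAbs as ≤ B
  maxAbs≤ []       []          = z≤n
  maxAbs≤ (a ∷ as) (a≤ ∷ as≤) = ℕ.⊔-lub a≤ (maxAbs≤ as as≤)

∈entries⇒≤norm : (f : LinPoly d) {a : ℤ} → a ∈ entries f → ∣ a ∣ ≤ norm f
∈entries⇒≤norm f = ≤maxAbs (entries f)

∣entry∣≤norm : (f : LinPoly d) (j : Fin (suc d)) → ∣ entry f j ∣ ≤ norm f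
∣entry∣≤norm f j = ∈entries⇒≤norm f (entry∈entries f j)

norm≤ : (f : LinPoly d) {B : ℕ} → (∀ j → ∣ entry f j ∣ ≤ B) → norm f ≤ B
norm≤ f {B} entry≤ = maxAbs≤ (entries f) (All.tabulate λ a∈ →
  let (j , a≡) = entries⇒entry a∈ in subst (λ a → ∣ a ∣ ≤ B) (sym a≡) (entry≤ j))

∣lc∣≤norm : (rk : Order d) (f : LinPoly d) → ∣ lc rk f ∣ ≤ norm f
∣lc∣≤norm rk f = let (j , lc≡) = lc-entry rk f in subst (λ a → ∣ a ∣ ≤ norm f) (sym lc≡) (∣entry∣≤norm f j)

norm-Spol : (rk : Order d) (g h : LinPoly d) → norm (Spol rk g h) ≤ (norm g + norm g) * norm h
norm-Spol rk g h = norm≤ (Spol rk g h) λ j → begin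
  ∣ entry (Spol rk g h) j ∣                            ≡⟨ cong ∣_∣ (entry-Spol rk g h j) ⟩
  ∣ lc rk h ℤ.* entry g j ℤ.- lc rk g ℤ.* entry h j ∣  ≤⟨ ℤ.∣i-j∣≤∣i∣+∣j∣ (lc rk h ℤ.* entry g j) _ ⟩
  ∣ lc rk h ℤ.* entry g j ∣ + ∣ lc rk g ℤ.* entry h j ∣ ≡⟨ cong₂ _+_ (ℤ.abs-* (lc rk h) _) (ℤ.abs-* (lc rk g) _) ⟩
  ∣ lc rk h ∣ * ∣ entry g j ∣ + ∣ lc rk g ∣ * ∣ entry h j ∣
    ≤⟨ ℕ.+-mono-≤ (ℕ.*-mono-≤ (∣lc∣≤norm rk h) (∣entry∣≤norm g j)) (ℕ.*-mono-≤ (∣lc∣≤norm rk g) (∣entry∣≤norm h j)) ⟩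
  norm h * norm g + norm g * norm h                   ≡⟨ cong (_+ norm g * norm h) (ℕ.*-comm (norm h) (norm g)) ⟩
  norm g * norm h + norm g * norm h                   ≡⟨ sym (ℕ.*-distribʳ-+ (norm h) (norm g) (norm g)) ⟩
  (norm g + norm g) * norm h                          ∎
  where open ℕ.≤-Reasoning

Term-norm : {Φ : System d} {t : LinPoly d} → Term Φ t → norm t ≤ normS Φ
Term-norm {Φ = (f , g) ∷ Φ} (here (inj₁ refl)) = ℕ.m≤n⇒m≤n⊔o (normS Φ) (ℕ.m≤m⊔n (norm f) (norm g))
Term-norm {Φ = (f , g) ∷ Φ} (here (inj₂ refl)) = ℕ.m≤n⇒m≤n⊔o (normS Φ) (ℕ.m≤n⊔m (norm f) (norm g))
Term-norm {Φ = (f , g) ∷ Φ} (there t∈)         = ℕ.m≤n⇒m≤o⊔n (norm f ⊔ norm g) (Term-norm t∈)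

length-cartesianProductWith : {A B C : Set} (f : A → B → C) (xs : List A) (ys : List B) →
  length (List.cartesianProductWith f xs ys) ≡ length xs * length ys
length-cartesianProductWith f []       ys = refl
length-cartesianProductWith f (x ∷ xs) ys = trans (List.length-++ (map (f x) ys))
  (cong₂ _+_ (List.length-map (f x) ys) (length-cartesianProductWith f xs ys))

length-concat≤ : {A : Set} {B : ℕ} (xss : List (List A)) → All (λ xs → length xs ≤ B) xss →
  length (List.concat xss) ≤ length xss * B
length-concat≤ []         []          = z≤n
length-concat≤ (xs ∷ xss) (xs≤ ∷ xss≤) = subst (_≤ _) (sym (List.length-++ xs)) (ℕ.+-mono-≤ xs≤ (length-concat≤ xss xss≤))

private
  ∈-─ : {A : Set} {x y : A} (xs : List A) (x∈ : x ∈ xs) → y ∈ xs → y ≢ x → y ∈ (xs Any.─ x∈)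
  ∈-─ (_ ∷ _)  (here refl) (here refl) y≢x = ⊥-elim (y≢x refl)
  ∈-─ (_ ∷ _)  (here _)    (there y∈)  _   = y∈
  ∈-─ (_ ∷ _)  (there _)   (here refl) _   = here refl
  ∈-─ (_ ∷ xs) (there x∈)  (there y∈)  y≢x = there (∈-─ xs x∈ y∈ y≢x)

Unique⇒length≤ : {A : Set} (xs ys : List A) → Unique xs → All (_∈ ys) xs → length xs ≤ length ys
Unique⇒length≤ []       ys _          _           = z≤n
Unique⇒length≤ (x ∷ xs) ys (x∉ ∷ u) (x∈ ∷ xs⊆) =
  subst (suc (length xs) ≤_) (sym (List.length-removeAt′ ys (Any.index x∈)))
    (s≤s (Unique⇒length≤ xs (ys Any.─ x∈) u
      (All.zipWith (λ (y∈ , x≢y) → ∈-─ ys x∈ y∈ (x≢y ∘ sym)) (xs⊆ , x∉))))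

-- A finite cover of S(Δ(Φ))

terms : System d → List (LinPoly d)
terms = concatMap λ (f , g) → f ∷ g ∷ []

Term⇒∈terms : {Φ : System d} {t : LinPoly d} → Term Φ t → t ∈ terms Φ
Term⇒∈terms {Φ = _ ∷ _} (here (inj₁ refl)) = here refl
Term⇒∈terms {Φ = _ ∷ _} (here (inj₂ refl)) = there (here refl)
Term⇒∈terms {Φ = _ ∷ _} (there t∈)         = there (there (Term⇒∈terms t∈))

∈terms⇒Term : {Φ : System d} {t : LinPoly d} → t ∈ terms Φ → Term Φ t
∈terms⇒Term {Φ = _ ∷ _} (here refl)         = here (inj₁ refl)
∈terms⇒Term {Φ = _ ∷ _} (there (here refl)) = here (inj₂ refl)
∈terms⇒Term {Φ = _ ∷ _} (there (there t∈))  = there (∈terms⇒Term t∈)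

length-terms : (Φ : System d) → length (terms Φ) ≡ 2 * length Φ
length-terms []      = refl
length-terms (_ ∷ Φ) = trans (cong (suc ∘ suc) (length-terms Φ)) (sym (ℕ.*-suc 2 (length Φ)))

module Chains (rk : Order d) (Φ : System d) where

  rhsAt : LinPoly d → ℕ → System d → Maybe (LinPoly d)
  rhsAt f l []              = nothing
  rhsAt f l ((f' , g) ∷ Ψ) with f' ≟ f | lvl rk g ℕ.≟ l
  ... | yes _ | yes _ = just g
  ... | _     | _     = rhsAt f l Ψ

  rhsAt-sound : ∀ f l Ψ {g} → rhsAt f l Ψ ≡ just g → (f , g) ∈ Ψ × lvl rk g ≡ l
  rhsAt-sound f l ((f' , g') ∷ Ψ) found with f' ≟ f | lvl rk g' ℕ.≟ l
  rhsAt-sound f l ((f' , g') ∷ Ψ) refl | yes refl | yes l≡ = here refl , l≡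
  ... | yes _ | no _  = Product.map₁ there (rhsAt-sound f l Ψ found)
  ... | no _  | _     = Product.map₁ there (rhsAt-sound f l Ψ found)

  rhsAt-complete : ∀ f l Ψ {g} → (f , g) ∈ Ψ → lvl rk g ≡ l → Σ (LinPoly d) λ g' → rhsAt f l Ψ ≡ just g'
  rhsAt-complete f l ((f' , g') ∷ Ψ) fg∈ l≡ with f' ≟ f | lvl rk g' ℕ.≟ l
  ... | yes _ | yes _ = g' , refl
  rhsAt-complete f l ((f' , g') ∷ Ψ) (here refl) l≡  | yes _   | no l≢ = ⊥-elim (l≢ l≡)
  rhsAt-complete f l ((f' , g') ∷ Ψ) (there fg∈) l≡  | yes _   | no _  = rhsAt-complete f l Ψ fg∈ l≡
  rhsAt-complete f l ((f' , g') ∷ Ψ) (here refl) l≡  | no f'≢f | _     = ⊥-elim (f'≢f refl)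
  rhsAt-complete f l ((f' , g') ∷ Ψ) (there fg∈) l≡  | no _    | _     = rhsAt-complete f l Ψ fg∈ l≡

  chain : LinPoly d → ℕ → LinPoly d → List (LinPoly d)
  chain f zero    h = []
  chain f (suc n) h = maybe′ (λ g → Spol rk g h ∷ chain f n (Spol rk g h)) [] (rhsAt f (lvl rk h) Φ)

  length-chain : ∀ f n h → length (chain f n h) ≤ n
  length-chain f zero    h = z≤n
  length-chain f (suc n) h with rhsAt f (lvl rk h) Φ
  ... | nothing = z≤n
  ... | just g  = s≤s (length-chain f n (Spol rk g h))

  chain-suc : ∀ f n h {g} → rhsAt f (lvl rk h) Φ ≡ just g → chain f (suc n) h ≡ Spol rk g h ∷ chain f n (Spol rk g h)
  chain-suc f n h found = cong (maybe′ (λ g → Spol rk g h ∷ chain f n (Spol rk g h)) []) found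

  chain-norm : (A : ℕ) .{{_ : ℕ.NonZero A}} → normS Φ + normS Φ ≤ A →
    ∀ f n h k → norm h ≤ A ^ k → All (λ x → norm x ≤ A ^ (k + n)) (chain f n h)
  chain-norm A 2N≤A f zero    h k h≤ = []
  chain-norm A 2N≤A f (suc n) h k h≤ with rhsAt f (lvl rk h) Φ in found
  ... | nothing = []
  ... | just g  = ℕ.≤-trans S≤ (ℕ.^-monoʳ-≤ A (ℕ.≤-trans (ℕ.m≤m+n (suc k) n) (ℕ.≤-reflexive (sym (ℕ.+-suc k n)))))
                ∷ subst (λ e → All (λ x → norm x ≤ A ^ e) (chain f n (Spol rk g h))) (sym (ℕ.+-suc k n))
                    (chain-norm A 2N≤A f n (Spol rk g h) (suc k) S≤)
    where
    g≤ : norm g ≤ normS Φ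
    g≤ = Term-norm (rhs-Term (proj₁ (rhsAt-sound f (lvl rk h) Φ found)))
    S≤ : norm (Spol rk g h) ≤ A ^ suc k
    S≤ = ℕ.≤-trans (norm-Spol rk g h) (ℕ.*-mono-≤ (ℕ.≤-trans (ℕ.+-mono-≤ g≤ g≤) 2N≤A) h≤)

  module _ (rk-inj : Injective _≡_ _≡_ rk) (ep : ElimProp rk Φ) {f : LinPoly d} (f-lhs : LhsPrimPart Φ f) where
    open Elimination rk rk-inj ep f-lhs using (rhs-unique)

    chain-closed : ∀ n h₀ → lvl rk h₀ ≤ n → ∀ {g h} → h ∈ h₀ ∷ chain f n h₀ → (f , g) ∈ Φ → lvl rk g ≡ lvl rk h →
                   Spol rk g h ∈ chain f n h₀ ⊎ Spol rk g h ≡ 0P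
    chain-closed n h₀ h₀≤n {g} (here refl) fg∈ g≡ with rhsAt-complete f (lvl rk h₀) Φ fg∈ g≡
    ... | g' , found with rhsAt-sound f (lvl rk h₀) Φ found
    ... | fg'∈ , g'≡ with rhs-unique fg'∈ fg∈ (trans g'≡ (sym g≡)) | n
    ... | refl | zero   = let h₀≡0 = ℕ.n≤0⇒n≡0 h₀≤n in inj₂ (Spol-lvl≡0 rk g h₀ (trans g≡ h₀≡0) h₀≡0)
    ... | refl | suc n' = inj₁ (subst (Spol rk g h₀ ∈_) (sym (chain-suc f n' h₀ found)) (here refl))
    chain-closed (suc n) h₀ h₀≤n (there h∈) fg∈ g≡ with rhsAt f (lvl rk h₀) Φ in found
    ... | just g₀ with rhsAt-sound f (lvl rk h₀) Φ found
    ... | _ , g₀≡ = Sum.map₁ there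
      (chain-closed n (Spol rk g₀ h₀) (Spol-lvl-drop rk rk-inj g₀ h₀ g₀≡ h₀≤n) h∈ fg∈ g≡)

    ΔCovered : LinPoly d → Set
    ΔCovered h = h ∈ terms Φ ⊎ h ≡ 0P ⊎ Σ (LinPoly d) λ t → t ∈ terms Φ × h ∈ chain f d t

    Spol-covered : ∀ {g h} t → t ∈ terms Φ → h ∈ t ∷ chain f d t → (f , g) ∈ Φ → lvl rk g ≡ lvl rk h →
                   ΔCovered (Spol rk g h)
    Spol-covered t t∈ h∈ fg∈ g≡ =
      [ (λ S∈ → inj₂ (inj₂ (t , t∈ , S∈))) , inj₂ ∘ inj₁ ]′ (chain-closed d t (lvl≤d rk t) h∈ fg∈ g≡)

    Δ-cover : ∀ {h} → InΔ rk Φ f h → ΔCovered h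
    Δ-cover (term t∈) = inj₁ (Term⇒∈terms t∈)
    Δ-cover (spol {g} {h} fg∈ h∈Δ g≡) with Δ-cover h∈Δ
    ... | inj₁ h∈terms               = Spol-covered h h∈terms (here refl) fg∈ g≡
    ... | inj₂ (inj₁ refl)           = inj₂ (inj₁ (Spol-lvl≡0 rk g 0P (trans g≡ (lvl-0P rk)) (lvl-0P rk)))
    ... | inj₂ (inj₂ (t , t∈ , h∈)) = Spol-covered t t∈ (there h∈) fg∈ g≡

  chains : List (LinPoly d)
  chains = List.concat (List.cartesianProductWith (λ f t → chain f d t) (map proj₁ Φ) (terms Φ))

  Δlist : List (LinPoly d)
  Δlist = 0P ∷ terms Φ ++ chains

  SΔlist : List (LinPoly d)
  SΔlist = Δlist ++ List.cartesianProductWith (Spol rk) Δlist Δlist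

  module _ (wf : WellFormed Φ) (rk-inj : Injective _≡_ _≡_ rk) (ep : ElimProp rk Φ) where

    Δ⊆Δlist : ∀ {h} → InΔall rk Φ h → h ∈ Δlist
    Δ⊆Δlist (f , t , _ , _ , term t∈) = there (∈-++⁺ˡ (Term⇒∈terms t∈))
    Δ⊆Δlist (f , t , _ , (_ , pf , _) , h∈Δ@(spol fg∈ _ _)) with Δ-cover rk-inj ep (lhs-self wf fg∈ pf) h∈Δ
    ... | inj₁ h∈terms               = there (∈-++⁺ˡ h∈terms)
    ... | inj₂ (inj₁ h≡0)            = here h≡0
    ... | inj₂ (inj₂ (t' , t'∈ , h∈)) = there (∈-++⁺ʳ (terms Φ)
            (∈-concat⁺′ h∈ (∈-cartesianProductWith⁺ (λ f t → chain f d t) (∈-map⁺ proj₁ fg∈) t'∈)))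

    SΔ⊆SΔlist : ∀ {h} → SClos rk (InΔall rk Φ) h → h ∈ SΔlist
    SΔ⊆SΔlist (inj₁ h∈Δ)                     = ∈-++⁺ˡ (Δ⊆Δlist h∈Δ)
    SΔ⊆SΔlist (inj₂ (g , h , g∈ , h∈ , x≡)) =
      subst (_∈ SΔlist) (sym x≡) (∈-++⁺ʳ Δlist (∈-cartesianProductWith⁺ (Spol rk) (Δ⊆Δlist g∈) (Δ⊆Δlist h∈)))

  length-Δlist : length Δlist ≤ 1 + (2 * length Φ + length Φ * (2 * length Φ) * d)
  length-Δlist = s≤s (subst (_≤ _) (sym (List.length-++ (terms Φ)))
    (ℕ.+-mono-≤ (ℕ.≤-reflexive (length-terms Φ)) chains≤))
    where
    pairs = List.cartesianProductWith (λ f t → chain f d t) (map proj₁ Φ) (terms Φ)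
    chains≤ : length chains ≤ length Φ * (2 * length Φ) * d
    chains≤ = subst (λ n → length chains ≤ n * d)
      (trans (length-cartesianProductWith _ (map proj₁ Φ) (terms Φ)) (cong₂ _*_ (List.length-map proj₁ Φ) (length-terms Φ)))
      (length-concat≤ pairs (All.tabulate λ c∈ →
        let (f , t , _ , _ , c≡) = ∈-cartesianProductWith⁻ (λ f t → chain f d t) (map proj₁ Φ) (terms Φ) c∈
        in subst (λ c → length c ≤ d) (sym c≡) (length-chain f d t)))

  length-SΔlist : length SΔlist ≡ length Δlist + length Δlist * length Δlist
  length-SΔlist = trans (List.length-++ Δlist)
    (cong (λ n → length Δlist + n) (length-cartesianProductWith (Spol rk) Δlist Δlist))

  module _ (A : ℕ) .{{_ : ℕ.NonZero A}} (2N≤A : normS Φ + normS Φ ≤ A) where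

    terms-norm : ∀ {t} → t ∈ terms Φ → norm t ≤ A ^ 1
    terms-norm t∈ = ℕ.≤-trans (Term-norm (∈terms⇒Term {Φ = Φ} t∈))
                      (ℕ.≤-trans (ℕ.m≤m+n _ _) (subst (_ ≤_) (sym (ℕ.*-identityʳ A)) 2N≤A))

    Δlist-norm : ∀ {x} → x ∈ Δlist → norm x ≤ A ^ suc d
    Δlist-norm (here refl) = ℕ.≤-trans (norm≤ (0P {d}) (λ j → ℕ.≤-reflexive (cong ∣_∣ (entry-0P j)))) z≤n
    Δlist-norm (there x∈) with ∈-++⁻ (terms Φ) x∈
    ... | inj₁ x∈terms  = ℕ.≤-trans (terms-norm x∈terms) (ℕ.^-monoʳ-≤ A {1} {suc d} (s≤s z≤n))
    ... | inj₂ x∈chains =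
      let (c , x∈c , c∈) = ∈-concat⁻′ _ x∈chains
          (f , t , _ , t∈ , c≡) = ∈-cartesianProductWith⁻ (λ f t → chain f d t) (map proj₁ Φ) (terms Φ) c∈
      in All.lookup (chain-norm A 2N≤A f d t 1 (terms-norm t∈)) (subst (_ ∈_) c≡ x∈c)

    SΔlist-norm : 2 ≤ A → ∀ {x} → x ∈ SΔlist → norm x ≤ A ^ (1 + (suc d + suc d))
    SΔlist-norm 2≤A x∈ with ∈-++⁻ Δlist x∈
    ... | inj₁ x∈Δ = ℕ.≤-trans (Δlist-norm x∈Δ) (ℕ.^-monoʳ-≤ A (ℕ.≤-trans (ℕ.m≤m+n (suc d) (suc d)) (ℕ.n≤1+n _)))
    ... | inj₂ x∈S =
      let (g , h , g∈ , h∈ , x≡) = ∈-cartesianProductWith⁻ (Spol rk) Δlist Δlist x∈S in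
      subst (λ x → norm x ≤ _) (sym x≡) (begin
        norm (Spol rk g h)                        ≤⟨ norm-Spol rk g h ⟩
        (norm g + norm g) * norm h
          ≤⟨ ℕ.*-mono-≤ (ℕ.+-mono-≤ (Δlist-norm g∈) (Δlist-norm g∈)) (Δlist-norm h∈) ⟩
        (A ^ suc d + A ^ suc d) * A ^ suc d
          ≡⟨ cong (_* A ^ suc d) (cong (λ n → A ^ suc d + n) (sym (ℕ.+-identityʳ (A ^ suc d)))) ⟩
        (2 * A ^ suc d) * A ^ suc d                ≤⟨ ℕ.*-monoˡ-≤ (A ^ suc d) (ℕ.*-monoˡ-≤ (A ^ suc d) 2≤A) ⟩
        (A * A ^ suc d) * A ^ suc d                ≡⟨ ℕ.*-assoc A (A ^ suc d) (A ^ suc d) ⟩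
        A * (A ^ suc d * A ^ suc d)                ≡⟨ cong (A *_) (sym (ℕ.^-distribˡ-+-* A (suc d) (suc d))) ⟩
        A ^ (1 + (suc d + suc d))                  ∎)
      where open ℕ.≤-Reasoning

-- Bounding products of distinct primes

distinct-primes-∣ : ∀ ps {Q} → Unique ps → All Prime ps → All (ℕ._∣ Q) ps → product ps ℕ.∣ Q
distinct-primes-∣ []       _            _           _             = ℕ.1∣ _
distinct-primes-∣ (p ∷ ps) (p∉ps ∷ u) (pp ∷ pps) (p∣Q ∷ ps∣Q) with distinct-primes-∣ ps u pps ps∣Q
... | ℕ.divides r Q≡rP with euclidsLemma r (product ps) pp (subst (p ℕ.∣_) Q≡rP p∣Q)
... | inj₂ p∣P = ⊥-elim (All.lookup p∉ps (factorisationHasAllPrimeFactors pp p∣P pps) refl)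
... | inj₁ (ℕ.divides s refl) = ℕ.divides s (trans Q≡rP (ℕ.*-assoc s p (product ps)))

LogProdLE-by-divisor : {S : ℕ → Set} {Q B : ℕ} .{{_ : ℕ.NonZero Q}} →
  (∀ {p} → S p → Prime p × p ℕ.∣ Q) → Q ≤ 2 ^ B → LogProdLE S B
LogProdLE-by-divisor S⇒∣Q Q≤ ps u ps∈S = ℕ.≤-trans
  (ℕ.∣⇒≤ (distinct-primes-∣ ps u (All.map (proj₁ ∘ S⇒∣Q) ps∈S) (All.map (proj₂ ∘ S⇒∣Q) ps∈S))) Q≤

p∣n! : ∀ {p n} → 1 ≤ p → p ≤ n → p ℕ.∣ n !
p∣n! {suc p} _ p≤n = ℕ.∣-trans (ℕ.m∣m*n (p !)) (ℕ.m≤n⇒m!∣n! p≤n)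

n!≤n^n : ∀ n → n ! ≤ n ^ n
n!≤n^n zero    = ℕ.≤-refl
n!≤n^n (suc n) = ℕ.*-monoʳ-≤ (suc n) (ℕ.≤-trans (n!≤n^n n) (ℕ.^-monoˡ-≤ n (ℕ.n≤1+n n)))

n≤2^n : ∀ n → n ≤ 2 ^ n
n≤2^n zero    = z≤n
n≤2^n (suc n) = ℕ.+-mono-≤ (ℕ.m^n>0 2 n) (ℕ.≤-trans (n≤2^n n) (ℕ.m≤m+n (2 ^ n) 0))

n≤2^⌈log₂n⌉ : ∀ n → n ≤ 2 ^ ⌈log₂ n ⌉
n≤2^⌈log₂n⌉ n = go n (ℕ.<-wellFounded n)
  where
  go : ∀ n (rec : Acc _<_ n) → n ≤ 2 ^ ⌈log2⌉ n rec
  go zero                _        = z≤n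
  go (suc zero)          _        = s≤s z≤n
  go (suc (suc n)) (acc rs) = begin
    suc (suc n)                    ≤⟨ s≤s (s≤s n≤⌈n/2⌉+⌈n/2⌉) ⟩
    suc (suc (⌈ n /2⌉ + ⌈ n /2⌉))    ≡⟨ 2+[x+x]≡2*[1+x] ⌈ n /2⌉ ⟩
    2 * suc ⌈ n /2⌉                 ≤⟨ ℕ.*-monoʳ-≤ 2 (go (suc ⌈ n /2⌉) _) ⟩
    2 * 2 ^ ⌈log2⌉ (suc ⌈ n /2⌉) _  ∎
    where
    open ℕ.≤-Reasoning
    n≤⌈n/2⌉+⌈n/2⌉ : n ≤ ⌈ n /2⌉ + ⌈ n /2⌉
    n≤⌈n/2⌉+⌈n/2⌉ = subst (_≤ ⌈ n /2⌉ + ⌈ n /2⌉) (ℕ.⌊n/2⌋+⌈n/2⌉≡n n) (ℕ.+-monoˡ-≤ ⌈ n /2⌉ (ℕ.⌊n/2⌋≤⌈n/2⌉ n))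
    2+[x+x]≡2*[1+x] : ∀ x → suc (suc (x + x)) ≡ 2 * suc x
    2+[x+x]≡2*[1+x] = ℕ-Solver.solve-∀

entryProduct : LinPoly d → ℕ
entryProduct h = product (map (λ a → ∣ a ∣ ⊔ 1) (entries h))

witness : ℕ → List (LinPoly d) → ℕ
witness K hs = K ! * product (map entryProduct hs)

product≤^length : ∀ {B} ns → All (_≤ B) ns → product ns ≤ B ^ length ns
product≤^length []       []          = ℕ.≤-refl
product≤^length (n ∷ ns) (n≤ ∷ ns≤) = ℕ.*-mono-≤ n≤ (product≤^length ns ns≤)

∣entryProduct : ∀ {p} (h : LinPoly d) → DividesNZEntry p h → p ℕ.∣ entryProduct h
∣entryProduct h p∣ =
  let (a , a∈ , a≢0 , p∣a) = find p∣ in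
  ℕ.∣-trans (subst (_ ℕ.∣_) (sym (ℕ.m≥n⇒m⊔n≡m (ℕ.n≢0⇒n>0 (a≢0 ∘ ℤ.∣i∣≡0⇒i≡0)))) p∣a)
            (∈⇒∣product (∈-map⁺ (λ a → ∣ a ∣ ⊔ 1) a∈))

entryProduct≤ : ∀ {B} (h : LinPoly d) → norm h ≤ B → 1 ≤ B → entryProduct h ≤ B ^ suc d
entryProduct≤ {d} {B} h h≤ 1≤B = subst (λ n → entryProduct h ≤ B ^ n) length≡
  (product≤^length _ (AllP.map⁺ (All.tabulate λ {a} a∈ → ℕ.⊔-lub (ℕ.≤-trans (∈entries⇒≤norm h a∈) h≤) 1≤B)))
  where
  length≡ : length (map (λ a → ∣ a ∣ ⊔ 1) (entries h)) ≡ suc d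
  length≡ = trans (List.length-map _ (entries h)) (cong suc (Vec.length-toList (coef h)))

witness≢0 : ∀ K (hs : List (LinPoly d)) → ℕ.NonZero (witness K hs)
witness≢0 K hs = ℕ.m*n≢0 (K !) _ {{K ℕ.!≢0}} {{product≢0 (AllP.map⁺ (All.universal entryProduct≢0 hs))}}
  where
  entryProduct≢0 : (h : LinPoly _) → ℕ.NonZero (entryProduct h)
  entryProduct≢0 h = product≢0 (AllP.map⁺ (All.universal (λ a → ℕ.>-nonZero (ℕ.m≤n⊔m ∣ a ∣ 1)) (entries h)))

∣witness-factorial : ∀ {p K} (hs : List (LinPoly d)) → Prime p → p ≤ K → p ℕ.∣ witness K hs
∣witness-factorial hs pp p≤K = ℕ.∣-trans (p∣n! (ℕ.>-nonZero⁻¹ _ {{prime⇒nonZero pp}}) p≤K) (ℕ.m∣m*n _)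

∣witness-entry : ∀ {p h} K (hs : List (LinPoly d)) → h ∈ hs → DividesNZEntry p h → p ℕ.∣ witness K hs
∣witness-entry {h = h} K hs h∈ p∣ =
  ℕ.∣-trans (∣entryProduct h p∣) (ℕ.∣-trans (∈⇒∣product (∈-map⁺ entryProduct h∈)) (ℕ.n∣m*n (K !)))

witness≤ : ∀ {a c K} (hs : List (LinPoly d)) → K ≤ 2 ^ a → All (λ h → norm h ≤ 2 ^ c) hs →
  witness K hs ≤ 2 ^ (a * K + c * suc d * length hs)
witness≤ {d} {a} {c} {K} hs K≤ hs≤ = begin
  K ! * product (map entryProduct hs)          ≤⟨ ℕ.*-mono-≤ K!≤ products≤ ⟩
  (2 ^ a) ^ K * (2 ^ (c * suc d)) ^ length hs  ≡⟨ cong₂ _*_ (ℕ.^-*-assoc 2 a K) (ℕ.^-*-assoc 2 (c * suc d) (length hs)) ⟩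
  2 ^ (a * K) * 2 ^ (c * suc d * length hs)    ≡⟨ sym (ℕ.^-distribˡ-+-* 2 (a * K) _) ⟩
  2 ^ (a * K + c * suc d * length hs)          ∎
  where
  open ℕ.≤-Reasoning
  K!≤ : K ! ≤ (2 ^ a) ^ K
  K!≤ = ℕ.≤-trans (n!≤n^n K) (ℕ.^-monoˡ-≤ K K≤)
  entryProducts≤ : All (_≤ 2 ^ (c * suc d)) (map entryProduct hs)
  entryProducts≤ = AllP.map⁺ {f = entryProduct} (All.map (λ {h} h≤ →
    subst (entryProduct h ≤_) (ℕ.^-*-assoc 2 c (suc d)) (entryProduct≤ h h≤ (ℕ.m^n>0 2 c))) hs≤)
  products≤ : product (map entryProduct hs) ≤ (2 ^ (c * suc d)) ^ length hs
  products≤ = subst (λ n → product (map entryProduct hs) ≤ (2 ^ (c * suc d)) ^ n) (List.length-map entryProduct hs)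
                (product≤^length (map entryProduct hs) entryProducts≤)

2+2N≤2^bitlen : ∀ N → 2 * suc N ≤ 2 ^ bitlen N
2+2N≤2^bitlen N = ℕ.*-monoʳ-≤ 2 (subst (_≤ 2 ^ ⌈log₂ (N + 1) ⌉) (ℕ.+-comm N 1) (n≤2^⌈log₂n⌉ (N + 1)))

m≤m*m : ∀ m → m ≤ m * m
m≤m*m zero    = z≤n
m≤m*m (suc m) = ℕ.m≤m*n (suc m) (suc m)

exponent-ℙ : ∀ m d b → m * m + b * suc d * m ≤ m ^ 2 * (d + 2) * (b + 2)
exponent-ℙ m d b = begin
  m * m + b * suc d * m           ≤⟨ ℕ.+-monoʳ-≤ (m * m) (ℕ.*-monoʳ-≤ (b * suc d) (m≤m*m m)) ⟩
  m * m + b * suc d * (m * m)     ≡⟨ x+yx≡x[1+y] (m * m) (b * suc d) ⟩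
  m * m * (1 + b * suc d)         ≤⟨ ℕ.*-monoʳ-≤ (m * m) (subst (1 + b * suc d ≤_) (sym ([d+2][b+2] d b)) (ℕ.m≤m+n _ _)) ⟩
  m * m * ((d + 2) * (b + 2))     ≡⟨ xx[yz]≡x^2yz m (d + 2) (b + 2) ⟩
  m ^ 2 * (d + 2) * (b + 2)       ∎
  where
  open ℕ.≤-Reasoning
  x+yx≡x[1+y] : ∀ x y → x + y * x ≡ x * (1 + y)
  x+yx≡x[1+y] = ℕ-Solver.solve-∀
  [d+2][b+2] : ∀ d b → (d + 2) * (b + 2) ≡ 1 + b * suc d + (b + 2 * d + 3)
  [d+2][b+2] = ℕ-Solver.solve-∀
  xx[yz]≡x^2yz : ∀ x y z → x * x * (y * z) ≡ x * (x * 1) * y * z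
  xx[yz]≡x^2yz = ℕ-Solver.solve-∀

SΔ-count : ∀ m d {D K} → D ≤ 1 + (2 * suc m + suc m * (2 * suc m) * d) → K ≡ D + D * D →
  K ≤ 8 * (suc m ^ 4) * (d + 2) ^ 2
SΔ-count m d {D} {K} D≤ K≡ = begin
  K                       ≡⟨ K≡ ⟩
  D + D * D               ≤⟨ ℕ.+-mono-≤ D≤D₀ (ℕ.*-mono-≤ D≤D₀ D≤D₀) ⟩
  D₀ + D₀ * D₀            ≤⟨ ℕ.+-monoˡ-≤ (D₀ * D₀) (m≤m*m D₀) ⟩
  D₀ * D₀ + D₀ * D₀       ≡⟨ 2D₀²≡ (suc m) d ⟩
  8 * (suc m ^ 4) * (d + 2) ^ 2 ∎
  where
  open ℕ.≤-Reasoning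
  M = suc m
  D₀ = 2 * (M * M) * (d + 2)
  D≤D₀ : D ≤ D₀
  D≤D₀ = begin
    D                                         ≤⟨ D≤ ⟩
    1 + (2 * M + M * (2 * M) * d)             ≤⟨ ℕ.+-mono-≤ (ℕ.m≤m*n 1 (M * M)) (ℕ.+-monoˡ-≤ _ (ℕ.*-monoʳ-≤ 2 (m≤m*m M))) ⟩
    1 * (M * M) + (2 * (M * M) + M * (2 * M) * d) ≤⟨ ℕ.m≤m+n _ (M * M) ⟩
    1 * (M * M) + (2 * (M * M) + M * (2 * M) * d) + M * M ≡⟨ 4m²+2m²d≡2m²[d+2] M d ⟩
    D₀                                        ∎
    where
    4m²+2m²d≡2m²[d+2] : ∀ m d → 1 * (m * m) + (2 * (m * m) + m * (2 * m) * d) + m * m ≡ 2 * (m * m) * (d + 2)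
    4m²+2m²d≡2m²[d+2] = ℕ-Solver.solve-∀
  2D₀²≡ : ∀ m d → 2 * (m * m) * (d + 2) * (2 * (m * m) * (d + 2)) + 2 * (m * m) * (d + 2) * (2 * (m * m) * (d + 2))
                ≡ 8 * (m * (m * (m * (m * 1)))) * ((d + 2) * ((d + 2) * 1))
  2D₀²≡ = ℕ-Solver.solve-∀

1≤d+2 : ∀ d → 1 ≤ d + 2
1≤d+2 d = ℕ.≤-trans (s≤s z≤n) (ℕ.m≤n+m 2 d)

SΔ-count≤2^ : ∀ m d {K} → K ≤ 8 * (suc m ^ 4) * (d + 2) ^ 2 → K ≤ 2 ^ (8 * (suc m * (d + 2)))
SΔ-count≤2^ m d {K} K≤ = begin
  K                                    ≤⟨ K≤ ⟩
  8 * (M ^ 4) * t ^ 2                  ≤⟨ ℕ.m≤m*n (8 * (M ^ 4) * t ^ 2) (2 * t ^ 2) {{ℕ.>-nonZero 0<2t²}} ⟩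
  8 * (M ^ 4) * t ^ 2 * (2 * t ^ 2)    ≡⟨ 16m⁴t⁴≡[2mt]⁴ M t ⟩
  (2 * (M * t)) ^ 4                    ≤⟨ ℕ.^-monoˡ-≤ 4 (n≤2^n (2 * (M * t))) ⟩
  (2 ^ (2 * (M * t))) ^ 4              ≡⟨ ℕ.^-*-assoc 2 (2 * (M * t)) 4 ⟩
  2 ^ (2 * (M * t) * 4)                ≡⟨ cong (2 ^_) (ℕ.*-comm (2 * (M * t)) 4) ⟩
  2 ^ (4 * (2 * (M * t)))              ≡⟨ cong (2 ^_) (sym (ℕ.*-assoc 4 2 (M * t))) ⟩
  2 ^ (8 * (M * t))                    ∎
  where
  open ℕ.≤-Reasoning
  M = suc m
  t = d + 2
  0<2t² : 0 < 2 * t ^ 2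
  0<2t² = ℕ.*-mono-≤ {1} {2} (s≤s z≤n) (ℕ.^-monoˡ-≤ 2 (1≤d+2 d))
  16m⁴t⁴≡[2mt]⁴ : ∀ m t → 8 * (m * (m * (m * (m * 1)))) * (t * (t * 1)) * (2 * (t * (t * 1)))
                        ≡ (2 * (m * t)) * ((2 * (m * t)) * ((2 * (m * t)) * ((2 * (m * t)) * 1)))
  16m⁴t⁴≡[2mt]⁴ = ℕ-Solver.solve-∀

exponent-ℙ₀ : ∀ m d b {K} → K ≤ 8 * (suc m ^ 4) * (d + 2) ^ 2 →
  8 * (suc m * (d + 2)) * K + b * (1 + (suc d + suc d)) * suc d * K ≤ 64 * suc m ^ 5 * (d + 2) ^ 4 * (b + 2)
exponent-ℙ₀ m d b {K} K≤ = begin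
  8 * (M * t) * K + b * (1 + (suc d + suc d)) * suc d * K
    ≤⟨ ℕ.+-mono-≤ (ℕ.*-monoʳ-≤ (8 * (M * t)) K≤) (ℕ.*-mono-≤ (ℕ.*-mono-≤ (ℕ.*-monoʳ-≤ b 3+2d≤2t) (ℕ.n≤1+n (suc d))) K≤) ⟩
  8 * (M * t) * K₀ + b * (2 * t) * suc (suc d) * K₀
    ≡⟨ cong (λ s → 8 * (M * t) * K₀ + b * (2 * t) * s * K₀) (ℕ.+-comm 2 d) ⟩
  8 * (M * t) * K₀ + b * (2 * t) * t * K₀
    ≡⟨ expand M t b ⟩
  64 * M ^ 5 * t ^ 3 + 16 * b * M ^ 4 * t ^ 4
    ≤⟨ ℕ.+-mono-≤ (ℕ.m≤m*n (64 * M ^ 5 * t ^ 3) (2 * t) {{ℕ.>-nonZero (ℕ.*-mono-≤ {1} {2} (s≤s z≤n) (1≤d+2 d))}})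
                  (ℕ.m≤m*n (16 * b * M ^ 4 * t ^ 4) (4 * M)) ⟩
  64 * M ^ 5 * t ^ 3 * (2 * t) + 16 * b * M ^ 4 * t ^ 4 * (4 * M)
    ≡⟨ collect M t b ⟩
  64 * M ^ 5 * t ^ 4 * (b + 2) ∎
  where
  open ℕ.≤-Reasoning
  M = suc m
  t = d + 2
  K₀ = 8 * (M ^ 4) * t ^ 2
  3+2d≤2t : 1 + (suc d + suc d) ≤ 2 * t
  3+2d≤2t = subst (1 + (suc d + suc d) ≤_) (3+2d+1≡2[d+2] d) (ℕ.m≤m+n _ 1)
    where
    3+2d+1≡2[d+2] : ∀ d → 1 + (suc d + suc d) + 1 ≡ 2 * (d + 2)
    3+2d+1≡2[d+2] = ℕ-Solver.solve-∀
  expand : ∀ m t b → 8 * (m * t) * (8 * (m * (m * (m * (m * 1)))) * (t * (t * 1)))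
                     + b * (2 * t) * t * (8 * (m * (m * (m * (m * 1)))) * (t * (t * 1)))
                   ≡ 64 * (m * (m * (m * (m * (m * 1))))) * (t * (t * (t * 1)))
                     + 16 * b * (m * (m * (m * (m * 1)))) * (t * (t * (t * (t * 1))))
  expand = ℕ-Solver.solve-∀
  collect : ∀ m t b → 64 * (m * (m * (m * (m * (m * 1))))) * (t * (t * (t * 1))) * (2 * t)
                      + 16 * b * (m * (m * (m * (m * 1)))) * (t * (t * (t * (t * 1)))) * (4 * m)
                    ≡ 64 * (m * (m * (m * (m * (m * 1))))) * (t * (t * (t * (t * 1)))) * (b + 2)
  collect = ℕ-Solver.solve-∀

ℙ-bound : (d : ℕ) (Φ : System d) → LogProdLE (PP Φ) (length Φ ^ 2 * (d + 2) * (bitlen (normS Φ) + 2))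
ℙ-bound d Φ = LogProdLE-by-divisor {B = m ^ 2 * (d + 2) * (b + 2)} {{witness≢0 m lhss}} ℙ∣witness
  (ℕ.≤-trans (witness≤ {a = m} {c = b} lhss (n≤2^n m) lhss≤) (ℕ.^-monoʳ-≤ 2 exponent≤))
  where
  m = length Φ
  b = bitlen (normS Φ)
  lhss = map proj₁ Φ
  ℙ∣witness : ∀ {p} → PP Φ p → Prime p × p ℕ.∣ witness m lhss
  ℙ∣witness (pp , inj₁ p≤m) = pp , ∣witness-factorial lhss pp p≤m
  ℙ∣witness (pp , inj₂ p∣lhs) = let (c , c∈ , p∣c) = find p∣lhs in pp , ∣witness-entry m lhss (∈-map⁺ proj₁ c∈) p∣c
  lhss≤ : All (λ h → norm h ≤ 2 ^ b) lhss
  lhss≤ = AllP.map⁺ (All.tabulate λ c∈ → ℕ.≤-trans (Term-norm (lhs-Term c∈))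
            (ℕ.≤-trans (ℕ.≤-trans (ℕ.n≤1+n _) (ℕ.m≤n*m _ 2)) (2+2N≤2^bitlen (normS Φ))))
  exponent≤ : m * m + b * suc d * length lhss ≤ m ^ 2 * (d + 2) * (b + 2)
  exponent≤ = subst (λ n → m * m + b * suc d * n ≤ m ^ 2 * (d + 2) * (b + 2)) (sym (List.length-map proj₁ Φ))
                (exponent-ℙ m d b)

ℙ₀-empty : {d : ℕ} (rk : Order d) → ∀ {p} → ¬ PP0 rk [] p
ℙ₀-empty rk (pp , inj₁ ([]     , _ , _      , z≤n)) = ¬prime[0] pp
ℙ₀-empty rk (pp , inj₁ (_ ∷ _ , _ , h∈ ∷ _ , _))   = SΔ[]-empty h∈
  where
  SΔ[]-empty : ∀ {h} → ¬ SClos rk (InΔall rk []) h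
  SΔ[]-empty (inj₁ (_ , _ , () , _))
  SΔ[]-empty (inj₂ (_ , _ , (_ , _ , () , _) , _))
ℙ₀-empty rk (pp , inj₂ (inj₁ (_ , inj₁ (_ , _ , () , _) , _)))
ℙ₀-empty rk (pp , inj₂ (inj₁ (_ , inj₂ (_ , _ , (_ , _ , () , _) , _) , _)))
ℙ₀-empty rk (pp , inj₂ (inj₂ (_ , () , _)))

ℙ₀-bound : (d : ℕ) (Φ : System d) → WellFormed Φ → (rk : Order d) → Injective _≡_ _≡_ rk → ElimProp rk Φ →
  LogProdLE (PP0 rk Φ) (64 * length Φ ^ 5 * (d + 2) ^ 4 * (bitlen (normS Φ) + 2))
-- Φ = [] separately: the counting bound for Δlist needs m ≥ 1, as Δlist always contains 0P
ℙ₀-bound d [] wf rk rk-inj ep []      _ _        = ℕ.m^n>0 2 (64 * 0 ^ 5 * (d + 2) ^ 4 * (bitlen 0 + 2))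
ℙ₀-bound d [] wf rk rk-inj ep (_ ∷ _) _ (p∈ ∷ _) = ⊥-elim (ℙ₀-empty rk p∈)
ℙ₀-bound d Φ@(_ ∷ Φ') wf rk rk-inj ep =
  LogProdLE-by-divisor {B = 64 * m ^ 5 * (d + 2) ^ 4 * (b + 2)} {{witness≢0 K SΔlist}} ℙ₀∣witness
    (ℕ.≤-trans (witness≤ {a = 8 * (m * (d + 2))} {c = b * R} SΔlist K≤2^ SΔlist≤)
               (ℕ.^-monoʳ-≤ 2 (exponent-ℙ₀ (length Φ') d b K≤)))
  where
  open Chains rk Φ
  m = length Φ
  b = bitlen (normS Φ)
  R = 1 + (suc d + suc d)
  K = length SΔlist
  K≤ : K ≤ 8 * (m ^ 4) * (d + 2) ^ 2
  K≤ = SΔ-count (length Φ') d length-Δlist length-SΔlist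
  K≤2^ : K ≤ 2 ^ (8 * (m * (d + 2)))
  K≤2^ = SΔ-count≤2^ (length Φ') d K≤
  2N≤2^b : normS Φ + normS Φ ≤ 2 ^ b
  2N≤2^b = ℕ.≤-trans (ℕ.+-mono-≤ (ℕ.n≤1+n _) (ℕ.≤-trans (ℕ.n≤1+n _) (ℕ.m≤m+n _ 0))) (2+2N≤2^bitlen (normS Φ))
  SΔlist≤ : All (λ h → norm h ≤ 2 ^ (b * R)) SΔlist
  SΔlist≤ = All.tabulate λ {h} h∈ → subst (norm h ≤_) (ℕ.^-*-assoc 2 b R)
    (SΔlist-norm (2 ^ b) {{ℕ.m^n≢0 2 b}} 2N≤2^b (ℕ.*-monoʳ-≤ 2 (ℕ.m^n>0 2 (b ℕ.∸ 1))) h∈)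
  ℙ₀∣witness : ∀ {p} → PP0 rk Φ p → Prime p × p ℕ.∣ witness K SΔlist
  ℙ₀∣witness (pp , inj₁ (hs , distinct , hs∈ , p≤)) =
    pp , ∣witness-factorial SΔlist pp
           (ℕ.≤-trans p≤ (Unique⇒length≤ hs SΔlist distinct (All.map (SΔ⊆SΔlist wf rk-inj ep) hs∈)))
  ℙ₀∣witness (pp , inj₂ (inj₁ (h , h∈ , p∣h))) = pp , ∣witness-entry K SΔlist (SΔ⊆SΔlist wf rk-inj ep h∈) p∣h
  ℙ₀∣witness (pp , inj₂ (inj₂ (f , _ , pf , g , _ , λ' , ml , p∣λ'))) =
    let (t , t∈ , p∣t) = minLambda-TermPrime rk rk-inj wf ep {f} {g} {λ'} pf ml pp p∣λ'
    in pp , ∣witness-entry K SΔlist (∈-++⁺ˡ (there (∈-++⁺ˡ (Term⇒∈terms t∈)))) p∣t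

lemma9 : (d : ℕ) (Φ : System d) → WellFormed Φ →
    LogProdLE (PP Φ) (length Φ ^ 2 * (d + 2) * (bitlen (normS Φ) + 2)) ×
    ((rk : Order d) → Injective _≡_ _≡_ rk → ElimProp rk Φ →
      LogProdLE (PP0 rk Φ)
        (64 * length Φ ^ 5 * (d + 2) ^ 4 * (bitlen (normS Φ) + 2)))
lemma9 d Φ wf = ℙ-bound d Φ , ℙ₀-bound d Φ wf
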